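{- Let $s,M$ be positive integers and $r$ a non-negative integer with $s+r\le M$. Then, as formal power series in $x,q$, \[ \frac{1}{(xq^s,xq^{s+r};q^M)_\infty}=\sum_{j\ge0}\frac{x^jq^{sj}}{(q^{2M};q^{2M})_{\lfloor j/2\rfloor}}\sum_{i=0}^{\lfloor j/2\rfloor}{\lfloor j/2\rfloor\brack i}_{q^{2M}}\frac{(-q^r;q^{2M})_{i+\lceil j/2\rceil-\lfloor j/2\rfloor}(-q^{M+r};q^{2M})_i}{(q^M;q^{2M})_{i+\lceil j/2\rceil-\lfloor j/2\rfloor}}(q^{2r})^{\lfloor j/2\rfloor-i}. \]
   Context: $(a;p)_k=\prod_{i=0}^{k-1}(1-ap^i)$, $(a;p)_\infty=\prod_{i\ge0}(1-ap^i)$, $(a,b;p)_\infty=(a;p)_\infty(b;p)_\infty$. For integers $0\le B\le A$, ${A\brack B}_p=\frac{(p;p)_A}{(p;p)_B(p;p)_{A-B}}$. $\lfloor\cdot\rfloor,\lceil\cdot\rceil$ are floor and ceiling. (The left side is the generating function, with $x$ counting parts, of partitions into parts congruent to $s$ or $s+r$ modulo $M$.) -}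

module Defs where

open import Data.Nat as ℕ using (ℕ; zero; suc; _∸_; ⌊_/2⌋; ⌈_/2⌉; _≟_)
open import Data.Nat.Divisibility using (_∣?_)
open import Data.Integer as ℤ using (ℤ; +_; -_)
open import Data.Bool using (if_then_else_)
open import Relation.Nullary using (does)

-- Formal power series in q with integer coefficients: n ↦ [q^n] f.
Series : Set
Series = ℕ → ℤ

sumTo : ℕ → (ℕ → ℤ) → ℤ
sumTo zero    h = h 0
sumTo (suc n) h = sumTo n h ℤ.+ h (suc n)

oneS : Series
oneS zero    = + 1
oneS (suc _) = + 0

zeroS : Series
zeroS _ = + 0

monoS : ℤ → ℕ → Series
monoS c e n = if does (n ≟ e) then c else + 0

_+S_ : Series → Series → Series
(f +S g) n = f n ℤ.+ g n

_*S_ : Series → Series → Series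
(f *S g) n = sumTo n (λ k → f k ℤ.* g (n ∸ k))

prodS : ℕ → (ℕ → Series) → Series
prodS zero    f = oneS
prodS (suc k) f = prodS k f *S f k

sumS : ℕ → (ℕ → Series) → Series
sumS k f n = sumTo k (λ i → f i n)

-- (a q^c ; q^d)_k = ∏_{i<k} (1 - a q^{c+i d}),  a ∈ ℤ (used with a = ±1)
poch : ℤ → ℕ → ℕ → ℕ → Series
poch a c d k = prodS k (λ i → oneS +S monoS (- a) (c ℕ.+ i ℕ.* d))

-- 1/(1 - q^e) = Σ_m q^{e m}   (the inverse power series; used only for e ≥ 1)
invOneMinus : ℕ → Series
invOneMinus e n = if does (e ∣? n) then + 1 else + 0

-- 1/(q^c ; q^d)_k = ∏_{i<k} 1/(1 - q^{c+i d})   (used only with c ≥ 1)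
invPoch : ℕ → ℕ → ℕ → Series
invPoch c d k = prodS k (λ i → invOneMinus (c ℕ.+ i ℕ.* d))

-- Gaussian binomial [A over B]_{q^d} = (p;p)_A / ((p;p)_B (p;p)_{A-B}), p = q^d
qbinom : ℕ → ℕ → ℕ → Series
qbinom d A B = (poch (+ 1) d d A *S invPoch d d B) *S invPoch d d (A ∸ B)

-- Formal power series in x and q: j ↦ coefficient of x^j (a series in q).
BSeries : Set
BSeries = ℕ → Series

oneB : BSeries
oneB zero    = oneS
oneB (suc _) = zeroS

_*B_ : BSeries → BSeries → BSeries
(F *B G) j n = sumTo j (λ k → (F k *S G (j ∸ k)) n)

prodB : ℕ → (ℕ → BSeries) → BSeries
prodB zero    f = oneB
prodB (suc k) f = prodB k f *B f k

-- 1/(1 - x q^a) = Σ_j x^j q^{a j}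
invOneMinusX : ℕ → BSeries
invOneMinusX a j = monoS (+ 1) (a ℕ.* j)

-- Truncation of 1/((x q^s ; q^M)_∞ (x q^{s+r} ; q^M)_∞) to its first N pairs of factors.
lhsTrunc : ℕ → ℕ → ℕ → ℕ → BSeries
lhsTrunc s r M N = prodB N (λ i → invOneMinusX (s ℕ.+ i ℕ.* M) *B invOneMinusX (s ℕ.+ r ℕ.+ i ℕ.* M))

-- Coefficient of x^j q^n in 1/((x q^s, x q^{s+r} ; q^M)_∞).
-- For s ≥ 1 all factors with index i ≥ n+1 have q-exponent > n, so the
-- product truncated at N = n+1 already has the exact coefficient.
lhsCoeff : ℕ → ℕ → ℕ → ℕ → ℕ → ℤ
lhsCoeff s r M j n = lhsTrunc s r M (suc n) j n

rhsSeries : ℕ → ℕ → ℕ → ℕ → Series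
rhsSeries s r M j =
  (monoS (+ 1) (s ℕ.* j) *S invPoch (2 ℕ.* M) (2 ℕ.* M) ⌊ j /2⌋) *S
  sumS ⌊ j /2⌋ (λ i →
    let e = ⌈ j /2⌉ ∸ ⌊ j /2⌋ in
    (((qbinom (2 ℕ.* M) ⌊ j /2⌋ i
      *S poch (- + 1) r (2 ℕ.* M) (i ℕ.+ e))
      *S poch (- + 1) (M ℕ.+ r) (2 ℕ.* M) i)
      *S invPoch M (2 ℕ.* M) (i ℕ.+ e))
      *S monoS (+ 1) ((2 ℕ.* r) ℕ.* (⌊ j /2⌋ ∸ i)))

module Submission where

-- Let σ be the substitution x ↦ q^M x.  Both sides F satisfy
--   F · (1 - q^s x)(1 - q^{s+r} x) = σF   with F(0) = 1,
-- and for M ≥ 1 such an F is unique (comparing coefficients of x^j gives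
-- F_j = q^{Mj} F_j + lower terms, and 1 - q^{Mj} is invertible).  For the
-- left-hand side the equation is the telescoping of its factors.  The
-- right-hand side is the product G·H of
--   G = Σ_k q^{sk} (-q^r; q^M)_k/(q^M; q^M)_k x^k,  with G(1 - q^s x) = σG(1 + q^{s+r} x),
--   H = Σ_t q^{2(s+r)t}/(q^{2M}; q^{2M})_t x^{2t},   with H(1 - q^{2(s+r)} x²) = σH,
-- which multiply to the same equation since (1 - q^a x)(1 + q^a x) = 1 - q^{2a} x²;
-- collecting the coefficient of x^j in G·H by the parity of j and splitting
-- the Pochhammer symbols of step M into steps 2M gives the stated formula.

open import Defs
open import Data.Nat using (ℕ; _+_; _≤_)
open import Relation.Binary.PropositionalEquality using (_≡_)

open import Level using (_⊔_) renaming (suc to lsuc)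
open import Algebra using (CommutativeRing; RawRing)
open import Algebra.Solver.Ring.AlmostCommutativeRing
  using (_-Raw-AlmostCommutative⟶_; fromCommutativeRing; Induced-equivalence)
import Algebra.Solver.Ring as RingSolver
open import Data.Nat as ℕ using (zero; suc; _*_; _∸_; _<_; z≤n; s≤s; _≟_; ⌊_/2⌋; ⌈_/2⌉)
import Data.Nat.Properties as ℕP
open import Data.Nat.Divisibility using (_∣_; _∣?_; divides; ∣m+n∣m⇒∣n; ∣m∸n∣n⇒∣m; ∣⇒≤; ∣-refl)
open import Data.Nat.Tactic.RingSolver using (solve-∀)
open import Data.Integer as ℤ using (ℤ; +_)
import Data.Integer.Properties as ℤP
open import Data.Bool using (if_then_else_)
open import Data.Maybe as Maybe using (Maybe)
open import Data.Empty using (⊥-elim)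
open import Data.Unit using (⊤; tt)
open import Data.Sum using (inj₁; inj₂)
open import Data.Product using (_,_)
open import Function using (_∘_)
open import Relation.Nullary using (Dec; yes; no; ¬_)
open import Relation.Nullary.Decidable using (dec-true; dec-false; dec⇒maybe)
import Relation.Binary.PropositionalEquality as ≡
open ≡ using (_≢_)
import Relation.Binary.Reasoning.Setoid as SetoidReasoning

-- 2·m, by a recursion that unfolds along with the parity of its argument.
double : ℕ → ℕ
double zero    = zero
double (suc m) = suc (suc (double m))

double≡2* : ∀ m → double m ≡ 2 * m
double≡2* zero    = ≡.refl
double≡2* (suc m) = ≡.trans (≡.cong (suc ∘ suc) (double≡2* m)) (≡.sym (ℕP.*-suc 2 m))

double-∸ : ∀ m i → double m ∸ double i ≡ double (m ∸ i)
double-∸ zero    zero    = ≡.refl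
double-∸ zero    (suc i) = ≡.refl
double-∸ (suc m) zero    = ≡.refl
double-∸ (suc m) (suc i) = double-∸ m i

double-∸-odd : ∀ m i → i < m → double m ∸ suc (double i) ≡ suc (double (m ∸ suc i))
double-∸-odd (suc m) zero    _         = ≡.refl
double-∸-odd (suc m) (suc i) (s≤s i<m) = double-∸-odd m i i<m

odd-∸-double : ∀ m i → i ≤ m → suc (double m) ∸ double i ≡ suc (double (m ∸ i))
odd-∸-double m       zero    _         = ≡.refl
odd-∸-double (suc m) (suc i) (s≤s i≤m) = odd-∸-double m i i≤m

⌊double/2⌋ : ∀ m → ⌊ double m /2⌋ ≡ m
⌊double/2⌋ zero    = ≡.refl
⌊double/2⌋ (suc m) = ≡.cong suc (⌊double/2⌋ m)

⌊odd/2⌋ : ∀ m → ⌊ suc (double m) /2⌋ ≡ m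
⌊odd/2⌋ zero    = ≡.refl
⌊odd/2⌋ (suc m) = ≡.cong suc (⌊odd/2⌋ m)

even-index : ∀ c d t → c + double t * d ≡ c + t * (2 * d)
even-index c d t = ≡.trans (≡.cong (λ u → c + u * d) (double≡2* t)) (arithmetic c d t)
  where arithmetic : ∀ c d t → c + 2 * t * d ≡ c + t * (2 * d)
        arithmetic = solve-∀

odd-index : ∀ c d t → c + suc (double t) * d ≡ d + c + t * (2 * d)
odd-index c d t = ≡.trans (≡.cong (λ u → c + suc u * d) (double≡2* t)) (arithmetic c d t)
  where arithmetic : ∀ c d t → c + (1 + 2 * t) * d ≡ d + c + t * (2 * d)
        arithmetic = solve-∀

data Parity : ℕ → Set where
  even : ∀ m → Parity (double m)
  odd  : ∀ m → Parity (suc (double m))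

parity : ∀ j → Parity j
parity zero          = even 0
parity (suc zero)    = odd 0
parity (suc (suc j)) with parity j
... | even m = even (suc m)
... | odd m  = odd (suc m)

-- This is exactly what the
-- ring solver needs to normalise polynomial identities with integer
-- coefficients; power series rings (below) inherit the structure.
ℤ-ring : CommutativeRing _ _
ℤ-ring = ℤP.+-*-commutativeRing

ℤ-raw : RawRing _ _
ℤ-raw = CommutativeRing.rawRing ℤ-ring

record ℤAlgebra c ℓ : Set (lsuc (c ⊔ ℓ)) where
  field
    ring  : CommutativeRing c ℓ
    fromℤ : ℤ-raw -Raw-AlmostCommutative⟶ fromCommutativeRing ring

ℤ-algebra : ℤAlgebra _ _
ℤ-algebra = record { ring = ℤ-ring ; fromℤ = record
  { ⟦_⟧ = λ a → a ; +-homo = λ _ _ → ≡.refl ; *-homo = λ _ _ → ≡.refl ; -‿homo = λ _ → ≡.refl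
  ; 0-homo = ≡.refl ; 1-homo = ≡.refl } }

module Solver {c ℓ} (𝔸 : ℤAlgebra c ℓ) where
  open ℤAlgebra 𝔸
  open CommutativeRing ring using (refl)

  coefficient≟ : ∀ a b → Maybe (Induced-equivalence fromℤ a b)
  coefficient≟ a b = Maybe.map (λ { ≡.refl → refl }) (dec⇒maybe (a ℤ.≟ b))

  open RingSolver ℤ-raw (fromCommutativeRing ring) fromℤ coefficient≟ public
    using (solve; _:=_; _:+_; _:*_; :-_; con)

module FiniteSums {c ℓ} (R : CommutativeRing c ℓ) where
  open CommutativeRing R hiding (zero) renaming (Carrier to A; _+_ to _+ᴿ_; _*_ to _*ᴿ_)
  open SetoidReasoning setoid

  ∑ : ℕ → (ℕ → A) → A
  ∑ zero    h = h 0
  ∑ (suc n) h = ∑ n h +ᴿ h (suc n)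

  ∑-cong : ∀ n {h h′ : ℕ → A} → (∀ i → i ≤ n → h i ≈ h′ i) → ∑ n h ≈ ∑ n h′
  ∑-cong zero    e = e 0 z≤n
  ∑-cong (suc n) e = +-cong (∑-cong n (λ i i≤n → e i (ℕP.m≤n⇒m≤1+n i≤n))) (e (suc n) ℕP.≤-refl)

  ∑-cong′ : ∀ n {h h′ : ℕ → A} → (∀ i → h i ≈ h′ i) → ∑ n h ≈ ∑ n h′
  ∑-cong′ n e = ∑-cong n (λ i _ → e i)

  ∑-head : ∀ n (h : ℕ → A) → ∑ (suc n) h ≈ h 0 +ᴿ ∑ n (h ∘ suc)
  ∑-head zero    h = refl
  ∑-head (suc n) h = trans (+-congʳ (∑-head n h)) (+-assoc _ _ _)

  ∑-+ : ∀ n (a b : ℕ → A) → ∑ n (λ i → a i +ᴿ b i) ≈ ∑ n a +ᴿ ∑ n b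
  ∑-+ zero    a b = refl
  ∑-+ (suc n) a b = trans (+-congʳ (∑-+ n a b)) (interchange _ _ _ _)
    where open import Algebra.Properties.CommutativeSemigroup +-commutativeSemigroup using (interchange)

  ∑-*ˡ : ∀ n x (a : ℕ → A) → x *ᴿ ∑ n a ≈ ∑ n (λ i → x *ᴿ a i)
  ∑-*ˡ zero    x a = refl
  ∑-*ˡ (suc n) x a = trans (distribˡ _ _ _) (+-congʳ (∑-*ˡ n x a))

  ∑-*ʳ : ∀ n x (a : ℕ → A) → ∑ n a *ᴿ x ≈ ∑ n (λ i → a i *ᴿ x)
  ∑-*ʳ n x a = trans (*-comm _ _) (trans (∑-*ˡ n x a) (∑-cong′ n (λ i → *-comm _ _)))

  ∑-zero : ∀ n {h : ℕ → A} → (∀ i → i ≤ n → h i ≈ 0#) → ∑ n h ≈ 0#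
  ∑-zero zero    e = e 0 z≤n
  ∑-zero (suc n) e =
    trans (+-cong (∑-zero n (λ i i≤n → e i (ℕP.m≤n⇒m≤1+n i≤n))) (e (suc n) ℕP.≤-refl)) (+-identityˡ _)

  ∑-reverse : ∀ n (h : ℕ → A) → ∑ n h ≈ ∑ n (λ k → h (n ∸ k))
  ∑-reverse zero    h = refl
  ∑-reverse (suc n) h = begin
    ∑ n h +ᴿ h (suc n)                  ≈⟨ +-comm _ _ ⟩
    h (suc n) +ᴿ ∑ n h                  ≈⟨ +-congˡ (∑-reverse n h) ⟩
    h (suc n) +ᴿ ∑ n (λ k → h (n ∸ k))  ≈⟨ ∑-head n (λ k → h (suc n ∸ k)) ⟨
    ∑ (suc n) (λ k → h (suc n ∸ k))     ∎

  ∑-triangle : ∀ n (F : ℕ → ℕ → A) →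
    ∑ n (λ i → ∑ (n ∸ i) (F i)) ≈ ∑ n (λ k → ∑ k (λ i → F i (k ∸ i)))
  ∑-triangle zero    F = refl
  ∑-triangle (suc n) F = begin
    ∑ (suc n) (λ i → ∑ (suc n ∸ i) (F i))                 ≈⟨ ∑-head n _ ⟩
    ∑ (suc n) (F 0) +ᴿ ∑ n (λ i → ∑ (n ∸ i) (F (suc i)))  ≈⟨ +-congˡ (∑-triangle n (F ∘ suc)) ⟩
    ∑ (suc n) (F 0) +ᴿ ∑ n (T ∘ suc)                      ≈⟨ +-congˡ (+-identityˡ _) ⟨
    ∑ (suc n) (F 0) +ᴿ (T 0 +ᴿ ∑ n (T ∘ suc))             ≈⟨ +-congˡ (∑-head n T) ⟨
    ∑ (suc n) (F 0) +ᴿ ∑ (suc n) T                        ≈⟨ ∑-+ (suc n) (F 0) T ⟨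
    ∑ (suc n) (λ k → F 0 k +ᴿ T k)                        ≈⟨ ∑-cong′ (suc n) diagonal ⟩
    ∑ (suc n) (λ k → ∑ k (λ i → F i (k ∸ i)))             ∎
    where
    -- the contribution of the terms with i ≥ 1 to the k-th diagonal
    T : ℕ → A
    T zero    = 0#
    T (suc k) = ∑ k (λ i → F (suc i) (k ∸ i))
    diagonal : ∀ k → F 0 k +ᴿ T k ≈ ∑ k (λ i → F i (k ∸ i))
    diagonal zero    = +-identityʳ _
    diagonal (suc k) = sym (∑-head k (λ i → F i (suc k ∸ i)))

  ∑-single : ∀ m e {h : ℕ → A} → e ≤ m → (∀ k → k ≢ e → h k ≈ 0#) → ∑ m h ≈ h e
  ∑-single zero    .zero z≤n z = refl
  ∑-single (suc m) e     e≤ z with ℕP.m≤n⇒m<n∨m≡n e≤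
  ... | inj₁ (s≤s e≤m) =
    trans (+-cong (∑-single m e e≤m z) (z (suc m) (λ eq → ℕP.<⇒≢ (s≤s e≤m) (≡.sym eq)))) (+-identityʳ _)
  ... | inj₂ ≡.refl =
    trans (+-congʳ (∑-zero m (λ i i≤m → z i (ℕP.<⇒≢ (s≤s i≤m))))) (+-identityˡ _)

  ∑-even : ∀ m (h : ℕ → A) → (∀ i → i < m → h (suc (double i)) ≈ 0#) →
    ∑ (double m) h ≈ ∑ m (h ∘ double)
  ∑-even zero    h z = refl
  ∑-even (suc m) h z = +-congʳ (trans
    (+-cong (∑-even m h (λ i i<m → z i (ℕP.m≤n⇒m≤1+n i<m))) (z m ℕP.≤-refl)) (+-identityʳ _))

  ∑-odd : ∀ m (h : ℕ → A) → (∀ i → i ≤ m → h (double i) ≈ 0#) →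
    ∑ (suc (double m)) h ≈ ∑ m (h ∘ suc ∘ double)
  ∑-odd zero    h z = trans (+-congʳ (z 0 z≤n)) (+-identityˡ _)
  ∑-odd (suc m) h z = +-congʳ (trans
    (+-cong (∑-odd m h (λ i i≤m → z i (ℕP.m≤n⇒m≤1+n i≤m))) (z (suc m) ℕP.≤-refl)) (+-identityʳ _))

-- Formal power series Σ_k f k·X^k over a ℤ-algebra R, where two series are
-- identified when their coefficients agree in every degree satisfying the
-- downward closed predicate Seen.  For Seen = (_≤ n) this is R[[X]]/(X^{n+1});
-- for Seen = (λ _ → ⊤) it is R[[X]] itself.
module PowerSeries {c ℓ} (𝔸 : ℤAlgebra c ℓ) (Seen : ℕ → Set)
                   (seen-down : ∀ {m k} → k ≤ m → Seen m → Seen k) where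
  open ℤAlgebra 𝔸 using (fromℤ) renaming (ring to R)
  open CommutativeRing R hiding (zero) renaming (Carrier to A; _+_ to _+ᴿ_; _*_ to _*ᴿ_)
  open FiniteSums R public
  private module R-Reasoning = SetoidReasoning setoid

  Seq : Set c
  Seq = ℕ → A

  infix 4 _≋_
  record _≋_ (f g : Seq) : Set ℓ where
    constructor coefficientwise
    field coeff : ∀ m → Seen m → f m ≈ g m
  open _≋_ public

  𝟘 : Seq
  𝟘 _ = 0#

  const : A → Seq
  const a zero    = a
  const a (suc _) = 0#

  𝟙 : Seq
  𝟙 = const 1#

  -- The ring operations are opaque, so that unification never unfolds a
  -- product of series into its coefficients; those are accessed through the
  -- lemmas ⊞-coeff, ⊟-coeff and ⊠-coeff.
  infixl 6 _⊞_
  infixl 7 _⊠_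
  opaque
    _⊞_ : Seq → Seq → Seq
    (f ⊞ g) m = f m +ᴿ g m

    ⊟_ : Seq → Seq
    (⊟ f) m = - f m

    _⊠_ : Seq → Seq → Seq
    (f ⊠ g) m = ∑ m (λ k → f k *ᴿ g (m ∸ k))

    ⊞-coeff : ∀ f g m → (f ⊞ g) m ≡ f m +ᴿ g m
    ⊞-coeff f g m = ≡.refl

    ⊟-coeff : ∀ f m → (⊟ f) m ≡ - f m
    ⊟-coeff f m = ≡.refl

    ⊠-coeff : ∀ f g m → (f ⊠ g) m ≡ ∑ m (λ k → f k *ᴿ g (m ∸ k))
    ⊠-coeff f g m = ≡.refl

  opaque
    unfolding _⊞_ ⊟_ _⊠_

    ⊞-cong : ∀ {f f′ g g′} → f ≋ f′ → g ≋ g′ → f ⊞ g ≋ f′ ⊞ g′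
    ⊞-cong e e′ = coefficientwise λ m p → +-cong (coeff e m p) (coeff e′ m p)

    ⊟-cong : ∀ {f f′} → f ≋ f′ → ⊟ f ≋ ⊟ f′
    ⊟-cong e = coefficientwise λ m p → -‿cong (coeff e m p)

    ⊞-assoc : ∀ f g h → (f ⊞ g) ⊞ h ≋ f ⊞ (g ⊞ h)
    ⊞-assoc _ _ _ = coefficientwise λ _ _ → +-assoc _ _ _

    ⊞-comm : ∀ f g → f ⊞ g ≋ g ⊞ f
    ⊞-comm _ _ = coefficientwise λ _ _ → +-comm _ _

    ⊞-identityˡ : ∀ f → 𝟘 ⊞ f ≋ f
    ⊞-identityˡ _ = coefficientwise λ _ _ → +-identityˡ _

    ⊞-identityʳ : ∀ f → f ⊞ 𝟘 ≋ f
    ⊞-identityʳ _ = coefficientwise λ _ _ → +-identityʳ _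

    ⊟-inverseˡ : ∀ f → ⊟ f ⊞ f ≋ 𝟘
    ⊟-inverseˡ _ = coefficientwise λ _ _ → -‿inverseˡ _

    ⊟-inverseʳ : ∀ f → f ⊞ ⊟ f ≋ 𝟘
    ⊟-inverseʳ _ = coefficientwise λ _ _ → -‿inverseʳ _

    ⊠-cong : ∀ {f f′ g g′} → f ≋ f′ → g ≋ g′ → f ⊠ g ≋ f′ ⊠ g′
    ⊠-cong ef eg = coefficientwise λ m sm → ∑-cong m (λ k k≤m →
      *-cong (coeff ef k (seen-down k≤m sm)) (coeff eg (m ∸ k) (seen-down (ℕP.m∸n≤m m k) sm)))

    ⊠-comm : ∀ f g → f ⊠ g ≋ g ⊠ f
    ⊠-comm f g = coefficientwise λ m _ → trans (∑-reverse m _) (∑-cong m (λ k k≤m →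
      trans (*-comm _ _) (reflexive (≡.cong (λ t → g t *ᴿ f (m ∸ k)) (ℕP.m∸[m∸n]≡n k≤m)))))

    -- associativity holds in every degree m, by exchanging the order of summation
    ⊠-assoc-at : ∀ f g h m → ((f ⊠ g) ⊠ h) m ≈ (f ⊠ (g ⊠ h)) m
    ⊠-assoc-at f g h m = begin
      ∑ m (λ k → ∑ k (λ i → f i *ᴿ g (k ∸ i)) *ᴿ h (m ∸ k))   ≈⟨ ∑-cong′ m (λ k → ∑-*ʳ k _ _) ⟩
      ∑ m (λ k → ∑ k (λ i → f i *ᴿ g (k ∸ i) *ᴿ h (m ∸ k)))   ≈⟨ ∑-cong m (λ k k≤m → ∑-cong k (λ i i≤k →
                                                                   trans (*-assoc _ _ _) (*-congˡ (*-congˡ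
                                                                     (reflexive (≡.cong h (split k≤m i≤k))))))) ⟩
      ∑ m (λ k → ∑ k (λ i → F i (k ∸ i)))                     ≈⟨ ∑-triangle m F ⟨
      ∑ m (λ i → ∑ (m ∸ i) (F i))                             ≈⟨ ∑-cong′ m (λ i → ∑-*ˡ (m ∸ i) _ _) ⟨
      ∑ m (λ i → f i *ᴿ ∑ (m ∸ i) (λ j → g j *ᴿ h (m ∸ i ∸ j))) ∎
      where
      open R-Reasoning
      F : ℕ → ℕ → A
      F i j = f i *ᴿ (g j *ᴿ h (m ∸ i ∸ j))
      split : ∀ {k i} → k ≤ m → i ≤ k → m ∸ k ≡ m ∸ i ∸ (k ∸ i)
      split {k} {i} k≤m i≤k =
        ≡.trans (≡.cong (m ∸_) (≡.sym (ℕP.m+[n∸m]≡n i≤k))) (≡.sym (ℕP.∸-+-assoc m i (k ∸ i)))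

    ⊠-assoc : ∀ f g h → (f ⊠ g) ⊠ h ≋ f ⊠ (g ⊠ h)
    ⊠-assoc f g h = coefficientwise λ m _ → ⊠-assoc-at f g h m

    ⊠-identityˡ : ∀ f → 𝟙 ⊠ f ≋ f
    ⊠-identityˡ f = coefficientwise λ
      { zero    _ → *-identityˡ _
      ; (suc m) _ → trans (∑-head m _) (trans (+-cong (*-identityˡ _) (∑-zero m (λ i _ → zeroˡ _))) (+-identityʳ _)) }

    ⊠-distribˡ : ∀ f g h → f ⊠ (g ⊞ h) ≋ f ⊠ g ⊞ f ⊠ h
    ⊠-distribˡ f g h = coefficientwise λ m _ → trans (∑-cong′ m (λ k → distribˡ _ _ _)) (∑-+ m _ _)

  ⊠-identityʳ : ∀ f → f ⊠ 𝟙 ≋ f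
  ⊠-identityʳ f = coefficientwise λ m p → trans (coeff (⊠-comm f 𝟙) m p) (coeff (⊠-identityˡ f) m p)

  ⊠-distribʳ : ∀ f g h → (g ⊞ h) ⊠ f ≋ g ⊠ f ⊞ h ⊠ f
  ⊠-distribʳ f g h = coefficientwise λ m p → trans (coeff (⊠-comm (g ⊞ h) f) m p)
    (trans (coeff (⊠-distribˡ f g h) m p) (coeff (⊞-cong (⊠-comm f g) (⊠-comm f h)) m p))

  seriesRing : CommutativeRing c ℓ
  seriesRing = record
    { Carrier = Seq ; _≈_ = _≋_ ; _+_ = _⊞_ ; _*_ = _⊠_ ; -_ = ⊟_ ; 0# = 𝟘 ; 1# = 𝟙
    ; isCommutativeRing = record
      { isRing = record
        { +-isAbelianGroup = record
          { isGroup = record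
            { isMonoid = record
              { isSemigroup = record
                { isMagma = record
                  { isEquivalence = record
                    { refl  = coefficientwise λ _ _ → refl
                    ; sym   = λ e → coefficientwise λ m p → sym (coeff e m p)
                    ; trans = λ e e′ → coefficientwise λ m p → trans (coeff e m p) (coeff e′ m p) }
                  ; ∙-cong = ⊞-cong }
                ; assoc = ⊞-assoc }
              ; identity = ⊞-identityˡ , ⊞-identityʳ }
            ; inverse = ⊟-inverseˡ , ⊟-inverseʳ
            ; ⁻¹-cong = ⊟-cong }
          ; comm = ⊞-comm }
        ; *-cong = ⊠-cong
        ; *-assoc = ⊠-assoc
        ; *-identity = ⊠-identityˡ , ⊠-identityʳ
        ; distrib = ⊠-distribˡ , ⊠-distribʳ
        }
      ; *-comm = ⊠-comm
      }
    }

  const-cong : ∀ {a b} → a ≈ b → const a ≋ const b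
  const-cong a≈b = coefficientwise λ { zero _ → a≈b ; (suc m) _ → refl }

  opaque
    unfolding _⊞_ ⊟_ _⊠_

    const-+ : ∀ a b → const (a +ᴿ b) ≋ const a ⊞ const b
    const-+ a b = coefficientwise λ { zero _ → refl ; (suc m) _ → sym (+-identityʳ _) }

    const-* : ∀ a b → const (a *ᴿ b) ≋ const a ⊠ const b
    const-* a b = coefficientwise λ
      { zero    _ → refl
      ; (suc m) _ → sym (trans (∑-head m _) (trans (+-cong (zeroʳ _) (∑-zero m (λ i _ → zeroˡ _))) (+-identityʳ _))) }

    const-neg : ∀ a → const (- a) ≋ ⊟ const a
    const-neg a = coefficientwise λ { zero _ → refl ; (suc m) _ → sym (trans (sym (+-identityʳ _)) (-‿inverseˡ _)) }

  const-0 : const 0# ≋ 𝟘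
  const-0 = coefficientwise λ { zero _ → refl ; (suc m) _ → refl }

  seriesAlgebra : ℤAlgebra c ℓ
  seriesAlgebra = record { ring = seriesRing ; fromℤ = record
    { ⟦_⟧    = const ∘ ⟦_⟧
    ; +-homo = λ a b → S.trans (const-cong (+-homo a b)) (const-+ _ _)
    ; *-homo = λ a b → S.trans (const-cong (*-homo a b)) (const-* _ _)
    ; -‿homo = λ a → S.trans (const-cong (-‿homo a)) (const-neg _)
    ; 0-homo = S.trans (const-cong 0-homo) const-0
    ; 1-homo = const-cong 1-homo } }
    where
    open _-Raw-AlmostCommutative⟶_ fromℤ
    module S = CommutativeRing seriesRing

  quadratic : A → A → A → Seq
  quadratic c₀ c₁ c₂ zero                = c₀
  quadratic c₀ c₁ c₂ (suc zero)          = c₁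
  quadratic c₀ c₁ c₂ (suc (suc zero))    = c₂
  quadratic c₀ c₁ c₂ (suc (suc (suc _))) = 0#

  opaque
    unfolding _⊠_
    quadratic-⊠₀ : ∀ c₀ c₁ c₂ f → (quadratic c₀ c₁ c₂ ⊠ f) 0 ≈ c₀ *ᴿ f 0
    quadratic-⊠₀ c₀ c₁ c₂ f = refl

    quadratic-⊠₁ : ∀ c₀ c₁ c₂ f → (quadratic c₀ c₁ c₂ ⊠ f) 1 ≈ c₀ *ᴿ f 1 +ᴿ c₁ *ᴿ f 0
    quadratic-⊠₁ c₀ c₁ c₂ f = refl

    quadratic-⊠₂ : ∀ c₀ c₁ c₂ f j →
      (quadratic c₀ c₁ c₂ ⊠ f) (suc (suc j)) ≈ c₀ *ᴿ f (suc (suc j)) +ᴿ (c₁ *ᴿ f (suc j) +ᴿ c₂ *ᴿ f j)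
    quadratic-⊠₂ c₀ c₁ c₂ f j =
      trans (∑-head (suc j) _) (+-congˡ (trans (∑-head j _) (+-congˡ
        (∑-single j 0 z≤n (λ { zero ne → ⊥-elim (ne ≡.refl) ; (suc k) _ → zeroˡ _ })))))

    leading-⊠ : ∀ j f g → (∀ k → k ≤ j → f k ≈ 0#) → (f ⊠ g) (suc j) ≈ f (suc j) *ᴿ g 0
    leading-⊠ j f g z = trans
      (+-cong (∑-zero j (λ k k≤j → trans (*-congʳ (z k k≤j)) (zeroˡ _)))
              (*-congˡ (reflexive (≡.cong g (ℕP.n∸n≡0 j)))))
      (+-identityˡ _)

  linear-⊠ : ∀ c₀ c₁ f j → (quadratic c₀ c₁ 0# ⊠ f) (suc j) ≈ c₀ *ᴿ f (suc j) +ᴿ c₁ *ᴿ f j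
  linear-⊠ c₀ c₁ f zero    = quadratic-⊠₁ c₀ c₁ 0# f
  linear-⊠ c₀ c₁ f (suc j) = trans (quadratic-⊠₂ c₀ c₁ 0# f j) (+-congˡ (trans (+-congˡ (zeroˡ (f j))) (+-identityʳ _)))

sumTo≡∑ : ∀ m h → sumTo m h ≡ FiniteSums.∑ ℤ-ring m h
sumTo≡∑ zero    h = ≡.refl
sumTo≡∑ (suc m) h = ≡.cong (ℤ._+ h (suc m)) (sumTo≡∑ m h)

q^ : ℕ → Series
q^ = monoS (+ 1)

monoS-at : ∀ c e → monoS c e e ≡ c
monoS-at c e = ≡.cong (if_then c else + 0) (dec-true (e ≟ e) ≡.refl)

monoS-off : ∀ c e k → k ≢ e → monoS c e k ≡ + 0
monoS-off c e k k≢e = ≡.cong (if_then c else + 0) (dec-false (k ≟ e) k≢e)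

invOneMinus-yes : ∀ e m → e ∣ m → invOneMinus e m ≡ + 1
invOneMinus-yes e m e∣m = ≡.cong (if_then + 1 else + 0) (dec-true (e ∣? m) e∣m)

invOneMinus-no : ∀ e m → ¬ e ∣ m → invOneMinus e m ≡ + 0
invOneMinus-no e m e∤m = ≡.cong (if_then + 1 else + 0) (dec-false (e ∣? m) e∤m)

invOneMinus-periodic : ∀ e m → e ≤ m → invOneMinus e m ≡ invOneMinus e (m ∸ e)
invOneMinus-periodic e m e≤m with e ∣? m | e ∣? (m ∸ e)
... | yes _   | yes _   = ≡.refl
... | no _    | no _    = ≡.refl
... | yes e∣m | no e∤m′ =
  ⊥-elim (e∤m′ (∣m+n∣m⇒∣n (≡.subst (e ∣_) (≡.sym (ℕP.m+[n∸m]≡n e≤m)) e∣m) ∣-refl))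
... | no e∤m  | yes e∣m′ = ⊥-elim (e∤m (∣m∸n∣n⇒∣m e e≤m e∣m′ ∣-refl))

-- Two consequences of J being an inverse of 1 - Q (stated as J - Q·J = 1).
module InverseFacts {c ℓ} (𝔸 : ℤAlgebra c ℓ) where
  open ℤAlgebra 𝔸 using (ring)
  open CommutativeRing ring hiding (zero) renaming (_+_ to _+ᴿ_; _*_ to _*ᴿ_)
  open SetoidReasoning setoid
  open Solver 𝔸

  cancel : ∀ {Q J x} → J +ᴿ - (Q *ᴿ J) ≈ 1# → x ≈ Q *ᴿ x → x ≈ 0#
  cancel {Q} {J} {x} inv x≈Qx = begin
    x                          ≈⟨ *-identityʳ x ⟨
    x *ᴿ 1#                    ≈⟨ *-congˡ inv ⟨
    x *ᴿ (J +ᴿ - (Q *ᴿ J))     ≈⟨ solve 3 (λ x Q J → x :* (J :+ :- (Q :* J)) := (x :+ :- (Q :* x)) :* J) refl x Q J ⟩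
    (x +ᴿ - (Q *ᴿ x)) *ᴿ J     ≈⟨ *-congʳ (+-congˡ (-‿cong x≈Qx)) ⟨
    (x +ᴿ - x) *ᴿ J            ≈⟨ *-congʳ (-‿inverseʳ x) ⟩
    0# *ᴿ J                    ≈⟨ zeroˡ J ⟩
    0#                         ∎

  solve-linear : ∀ {Q J y z} → J +ᴿ - (Q *ᴿ J) ≈ 1# → y ≈ z *ᴿ J → y ≈ Q *ᴿ y +ᴿ z
  solve-linear {Q} {J} {y} {z} inv y≈zJ = begin
    y                                       ≈⟨ y≈zJ ⟩
    z *ᴿ J                                  ≈⟨ solve 3 (λ Q J z → z :* J := Q :* (z :* J) :+ z :* (J :+ :- (Q :* J))) refl Q J z ⟩
    Q *ᴿ (z *ᴿ J) +ᴿ z *ᴿ (J +ᴿ - (Q *ᴿ J)) ≈⟨ +-cong (*-congˡ (sym y≈zJ)) (*-congˡ inv) ⟩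
    Q *ᴿ y +ᴿ z *ᴿ 1#                       ≈⟨ +-congˡ (*-identityʳ z) ⟩
    Q *ᴿ y +ᴿ z                             ∎

-- Integer power series in q, compared up to degree n: the ring ℤ[[q]]/(q^{n+1}).
module TruncatedSeries (n : ℕ) where
  private module PS = PowerSeries ℤ-algebra (_≤ n) (λ k≤m m≤n → ℕP.≤-trans k≤m m≤n)
  open PS using (⊠-coeff; ∑-zero; ∑-single)
  open PS public using (coefficientwise; coeff; ⊞-coeff; ⊟-coeff)

  S-algebra : ℤAlgebra _ _
  S-algebra = PS.seriesAlgebra

  S : CommutativeRing _ _
  S = PS.seriesRing

  module S = CommutativeRing S
  open import Algebra.Properties.Ring S.ring public using (-‿distribˡ-*; -0#≈0#)
  module S-Reasoning = SetoidReasoning S.setoid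
  open Solver S-algebra public using (_:=_; _:+_; _:*_; :-_; con) renaming (solve to solveS)

  *S≈ : ∀ f g → (f *S g) S.≈ (f S.* g)
  *S≈ f g = coefficientwise λ m _ → ≡.trans (sumTo≡∑ m _) (≡.sym (⊠-coeff f g m))

  *S≈-cong : ∀ {a a′ b b′} → a S.≈ a′ → b S.≈ b′ → (a *S b) S.≈ a′ S.* b′
  *S≈-cong {a} {a′} {b} {b′} a≈a′ b≈b′ = S.trans (*S≈ a b) (S.*-cong a≈a′ b≈b′)

  oneS≈ : oneS S.≈ S.1#
  oneS≈ = coefficientwise λ { zero _ → ≡.refl ; (suc m) _ → ≡.refl }

  monoS-shift : ∀ c e f m → e ≤ m → (monoS c e S.* f) m ≡ c ℤ.* f (m ∸ e)
  monoS-shift c e f m e≤m = ≡.trans (⊠-coeff (monoS c e) f m) (≡.trans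
    (∑-single m e {h = λ k → monoS c e k ℤ.* f (m ∸ k)} e≤m (λ k k≢e → off-diagonal k k≢e))
    (≡.cong (ℤ._* f (m ∸ e)) (monoS-at c e)))
    where
    off-diagonal : ∀ k → k ≢ e → monoS c e k ℤ.* f (m ∸ k) ≡ + 0
    off-diagonal k k≢e = ≡.trans (≡.cong (ℤ._* f (m ∸ k)) (monoS-off c e k k≢e)) (ℤP.*-zeroˡ (f (m ∸ k)))

  monoS-shift-below : ∀ c e f m → m < e → (monoS c e S.* f) m ≡ + 0
  monoS-shift-below c e f m m<e = ≡.trans (⊠-coeff (monoS c e) f m)
    (∑-zero m {h = λ k → monoS c e k ℤ.* f (m ∸ k)} (λ k k≤m →
      ≡.trans (≡.cong (ℤ._* f (m ∸ k)) (monoS-off c e k (ℕP.<⇒≢ (ℕP.≤-<-trans k≤m m<e)))) (ℤP.*-zeroˡ (f (m ∸ k)))))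

  q^-cong : ∀ {a b} → a ≡ b → q^ a S.≈ q^ b
  q^-cong eq = S.reflexive (≡.cong q^ eq)

  q^-+-at : ∀ a b m → q^ (a + b) m ≡ (q^ a S.* q^ b) m
  q^-+-at a b m with a ℕ.≤? m
  ... | no a≰m = ≡.trans (monoS-off (+ 1) (a + b) m (λ eq → a≰m (≡.subst (a ≤_) (≡.sym eq) (ℕP.m≤m+n a b))))
                         (≡.sym (monoS-shift-below (+ 1) a (q^ b) m (ℕP.≰⇒> a≰m)))
  ... | yes a≤m = ≡.trans (exponents (m ≟ a + b))
                          (≡.sym (≡.trans (monoS-shift (+ 1) a (q^ b) m a≤m) (ℤP.*-identityˡ _)))
    where
    m∸a≡b⇔ : m ∸ a ≡ b → m ≡ a + b
    m∸a≡b⇔ eq = ≡.trans (≡.sym (ℕP.m+[n∸m]≡n a≤m)) (≡.cong (λ t → a + t) eq)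
    exponents : Dec (m ≡ a + b) → q^ (a + b) m ≡ q^ b (m ∸ a)
    exponents (yes ≡.refl) = ≡.trans (monoS-at (+ 1) (a + b)) (≡.sym (≡.subst (λ t → q^ b t ≡ + 1)
                                        (≡.sym (ℕP.m+n∸m≡n a b)) (monoS-at (+ 1) b)))
    exponents (no m≢a+b)   = ≡.trans (monoS-off (+ 1) (a + b) m m≢a+b)
                                     (≡.sym (monoS-off (+ 1) b (m ∸ a) (m≢a+b ∘ m∸a≡b⇔)))

  q^-+ : ∀ a b → q^ (a + b) S.≈ q^ a S.* q^ b
  q^-+ a b = coefficientwise λ m _ → q^-+-at a b m

  q^-0 : q^ 0 S.≈ S.1#
  q^-0 = coefficientwise λ { zero _ → ≡.refl ; (suc m) _ → ≡.refl }

  q^-*0 : ∀ a → q^ (a * 0) S.≈ S.1#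
  q^-*0 a = S.trans (q^-cong (ℕP.*-zeroʳ a)) q^-0

  q^-beyond : ∀ e → n < e → q^ e S.≈ S.0#
  q^-beyond e n<e = coefficientwise λ m m≤n → monoS-off (+ 1) e m (ℕP.<⇒≢ (ℕP.≤-<-trans m≤n n<e))

  monoS-neg-at : ∀ e m → monoS (ℤ.- + 1) e m ≡ ℤ.- q^ e m
  monoS-neg-at e m with m ≟ e
  ... | yes ≡.refl = ≡.trans (monoS-at _ e) (≡.cong ℤ.-_ (≡.sym (monoS-at _ e)))
  ... | no m≢e     = ≡.trans (monoS-off _ e m m≢e) (≡.cong ℤ.-_ (≡.sym (monoS-off _ e m m≢e)))

  monoS-neg : ∀ e → monoS (ℤ.- + 1) e S.≈ S.- q^ e
  monoS-neg e = coefficientwise λ m _ → ≡.trans (monoS-neg-at e m) (≡.sym (⊟-coeff (q^ e) m))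

  geometric-at : ∀ e → 1 ≤ e → ∀ m → invOneMinus e m ℤ.+ ℤ.- (q^ e S.* invOneMinus e) m ≡ S.1# m
  geometric-at e 1≤e zero = ≡.cong₂ (λ x y → x ℤ.+ ℤ.- y) (invOneMinus-yes e 0 (divides 0 ≡.refl))
                                   (monoS-shift-below (+ 1) e (invOneMinus e) 0 1≤e)
  geometric-at e 1≤e (suc m) with e ℕ.≤? suc m
  ... | yes e≤m = ≡.trans
        (≡.cong₂ (λ x y → x ℤ.+ ℤ.- y) (invOneMinus-periodic e (suc m) e≤m)
                 (≡.trans (monoS-shift (+ 1) e (invOneMinus e) (suc m) e≤m) (ℤP.*-identityˡ _)))
        (ℤP.+-inverseʳ (invOneMinus e (suc m ∸ e)))
  ... | no e≰m = ≡.cong₂ (λ x y → x ℤ.+ ℤ.- y) (invOneMinus-no e (suc m) (λ e∣m → e≰m (∣⇒≤ e∣m)))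
                                               (monoS-shift-below (+ 1) e (invOneMinus e) (suc m) (ℕP.≰⇒> e≰m))

  geometric : ∀ e → 1 ≤ e → invOneMinus e S.+ S.- (q^ e S.* invOneMinus e) S.≈ S.1#
  geometric e 1≤e = coefficientwise λ m _ → ≡.trans
    (≡.trans (⊞-coeff (invOneMinus e) _ m) (≡.cong (λ t → invOneMinus e m ℤ.+ t) (⊟-coeff (q^ e S.* invOneMinus e) m)))
    (geometric-at e 1≤e m)

  open InverseFacts S-algebra public using (cancel; solve-linear)

  factor≈ : ∀ a e → (oneS +S monoS a e) S.≈ (S.1# S.+ monoS a e)
  factor≈ a e = coefficientwise λ m p →
    ≡.trans (≡.cong (ℤ._+ monoS a e m) (coeff oneS≈ m p)) (≡.sym (⊞-coeff S.1# (monoS a e) m))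

  prodS-suc : ∀ k f → prodS (suc k) f S.≈ prodS k f S.* f k
  prodS-suc k f = *S≈ (prodS k f) (f k)

  prodS-cong : ∀ k {f g} → (∀ i → f i S.≈ g i) → prodS k f S.≈ prodS k g
  prodS-cong zero    e = S.refl
  prodS-cong (suc k) {f} {g} e =
    S.trans (prodS-suc k f) (S.trans (S.*-cong (prodS-cong k e) (e k)) (S.sym (prodS-suc k g)))

  prodS-one : ∀ k {f} → (∀ i → f i S.≈ S.1#) → prodS k f S.≈ S.1#
  prodS-one zero    e = oneS≈
  prodS-one (suc k) {f} e =
    S.trans (prodS-suc k f) (S.trans (S.*-cong (prodS-one k e) (e k)) (S.*-identityˡ S.1#))

  prodS-* : ∀ k f g → prodS k f S.* prodS k g S.≈ prodS k (λ i → f i S.* g i)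
  prodS-* zero    f g = S.trans (S.*-cong oneS≈ oneS≈) (S.trans (S.*-identityˡ S.1#) (S.sym oneS≈))
  prodS-* (suc k) f g = S-Reasoning.begin
    prodS (suc k) f S.* prodS (suc k) g             S-Reasoning.≈⟨ S.*-cong (prodS-suc k f) (prodS-suc k g) ⟩
    (prodS k f S.* f k) S.* (prodS k g S.* g k)     S-Reasoning.≈⟨ interchange (prodS k f) (f k) (prodS k g) (g k) ⟩
    (prodS k f S.* prodS k g) S.* (f k S.* g k)     S-Reasoning.≈⟨ S.*-congʳ (prodS-* k f g) ⟩
    prodS k (λ i → f i S.* g i) S.* (f k S.* g k)   S-Reasoning.≈⟨ prodS-suc k (λ i → f i S.* g i) ⟨
    prodS (suc k) (λ i → f i S.* g i)               S-Reasoning.∎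
    where interchange = solveS 4 (λ a x b y → (a :* x) :* (b :* y) := (a :* b) :* (x :* y)) S.refl

  prodS-even : ∀ i f → prodS (double i) f S.≈ prodS i (f ∘ double) S.* prodS i (f ∘ suc ∘ double)
  prodS-even zero    f = S.trans oneS≈ (S.trans (S.sym (S.*-identityˡ S.1#)) (S.sym (S.*-cong oneS≈ oneS≈)))
  prodS-even (suc i) f = S-Reasoning.begin
    prodS (suc (suc (double i))) f                 S-Reasoning.≈⟨ S.trans (prodS-suc (suc (double i)) f) (S.*-congʳ (prodS-suc (double i) f)) ⟩
    (prodS (double i) f S.* x) S.* y               S-Reasoning.≈⟨ S.*-congʳ (S.*-congʳ (prodS-even i f)) ⟩
    ((Pₑ S.* Pₒ) S.* x) S.* y                      S-Reasoning.≈⟨ solveS 4 (λ a b x y → ((a :* b) :* x) :* y := (a :* x) :* (b :* y)) S.refl Pₑ Pₒ x y ⟩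
    (Pₑ S.* x) S.* (Pₒ S.* y)                      S-Reasoning.≈⟨ S.*-cong (prodS-suc i (f ∘ double)) (prodS-suc i (f ∘ suc ∘ double)) ⟨
    prodS (suc i) (f ∘ double) S.* prodS (suc i) (f ∘ suc ∘ double) S-Reasoning.∎
    where
    Pₑ = prodS i (f ∘ double)
    Pₒ = prodS i (f ∘ suc ∘ double)
    x = f (double i)
    y = f (suc (double i))

  prodS-odd : ∀ i f → prodS (suc (double i)) f S.≈ prodS (suc i) (f ∘ double) S.* prodS i (f ∘ suc ∘ double)
  prodS-odd i f = S-Reasoning.begin
    prodS (suc (double i)) f                       S-Reasoning.≈⟨ prodS-suc (double i) f ⟩
    prodS (double i) f S.* x                       S-Reasoning.≈⟨ S.*-congʳ (prodS-even i f) ⟩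
    (Pₑ S.* Pₒ) S.* x                              S-Reasoning.≈⟨ solveS 3 (λ a b x → (a :* b) :* x := (a :* x) :* b) S.refl Pₑ Pₒ x ⟩
    (Pₑ S.* x) S.* Pₒ                              S-Reasoning.≈⟨ S.*-congʳ (prodS-suc i (f ∘ double)) ⟨
    prodS (suc i) (f ∘ double) S.* Pₒ              S-Reasoning.∎
    where
    Pₑ = prodS i (f ∘ double)
    Pₒ = prodS i (f ∘ suc ∘ double)
    x = f (double i)

  -- ∏_{i<k} φ(c + i·d); poch a = progression (pochFactor a) and
  -- invPoch = progression invOneMinus are of this shape.
  progression : (ℕ → Series) → ℕ → ℕ → ℕ → Series
  progression φ c d k = prodS k (λ i → φ (c + i * d))

  pochFactor : ℤ → ℕ → Series
  pochFactor a e = oneS +S monoS (ℤ.- a) e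

  progression-even : ∀ φ c d i →
    progression φ c d (double i) S.≈ progression φ c (2 * d) i S.* progression φ (d + c) (2 * d) i
  progression-even φ c d i = S.trans (prodS-even i _) (S.*-cong
    (prodS-cong i (λ t → S.reflexive (≡.cong φ (even-index c d t))))
    (prodS-cong i (λ t → S.reflexive (≡.cong φ (odd-index c d t)))))

  progression-odd : ∀ φ c d i →
    progression φ c d (suc (double i)) S.≈ progression φ c (2 * d) (suc i) S.* progression φ (d + c) (2 * d) i
  progression-odd φ c d i = S.trans (prodS-odd i _) (S.*-cong
    (prodS-cong (suc i) (λ t → S.reflexive (≡.cong φ (even-index c d t))))
    (prodS-cong i (λ t → S.reflexive (≡.cong φ (odd-index c d t)))))

  invPoch-poch : ∀ c d k → 1 ≤ c → invPoch c d k S.* poch (+ 1) c d k S.≈ S.1#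
  invPoch-poch c d k 1≤c = S.trans (prodS-* k _ _) (prodS-one k inverse)
    where
    inverse : ∀ i → let e = c + i * d in invOneMinus e S.* (oneS +S monoS (ℤ.- + 1) e) S.≈ S.1#
    inverse i = S-Reasoning.begin
      J S.* (oneS +S monoS (ℤ.- + 1) e) S-Reasoning.≈⟨ S.*-congˡ (S.trans (factor≈ (ℤ.- + 1) e) (S.+-congˡ (monoS-neg e))) ⟩
      J S.* (S.1# S.+ S.- q^ e)         S-Reasoning.≈⟨ solveS 2 (λ J Q → J :* (con (+ 1) :+ :- Q) := J :+ :- (Q :* J)) S.refl J (q^ e) ⟩
      J S.+ S.- (q^ e S.* J)            S-Reasoning.≈⟨ geometric e (ℕP.≤-trans 1≤c (ℕP.m≤m+n c (i * d))) ⟩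
      S.1#                              S-Reasoning.∎
      where
      e = c + i * d
      J = invOneMinus e

-- Power series in x whose coefficients are q-series modulo q^{n+1}.
module Bivariate (n : ℕ) where
  open TruncatedSeries n public
  private module PB = PowerSeries S-algebra (λ _ → ⊤) (λ _ _ → tt)
  open PB public using (∑; ∑-cong; ∑-*ˡ; ∑-even; ∑-odd;
                        quadratic; quadratic-⊠₀; quadratic-⊠₁; quadratic-⊠₂; linear-⊠; leading-⊠)
    renaming (coefficientwise to coefficientwiseB; coeff to coeffB;
              ⊞-coeff to ⊞-coeffB; ⊟-coeff to ⊟-coeffB; ⊠-coeff to ⊠-coeffB)

  B-algebra : ℤAlgebra _ _
  B-algebra = PB.seriesAlgebra

  B : CommutativeRing _ _
  B = PB.seriesRing

  module B = CommutativeRing B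
  module B-Reasoning = SetoidReasoning B.setoid
  open Solver B-algebra public using () renaming
    (solve to solveB; _:=_ to _:=ᴮ_; _:+_ to _:+ᴮ_; _:*_ to _:*ᴮ_; :-_ to :-ᴮ_; con to conᴮ)

  ∑-at : ∀ j (h : ℕ → Series) m → ∑ j h m ≡ sumTo j (λ k → h k m)
  ∑-at zero    h m = ≡.refl
  ∑-at (suc j) h m = ≡.trans (⊞-coeff (∑ j h) (h (suc j)) m) (≡.cong (ℤ._+ h (suc j) m) (∑-at j h m))

  *B≈ : ∀ F G → (F *B G) B.≈ (F B.* G)
  *B≈ F G = coefficientwiseB λ j _ → coefficientwise λ m m≤n → ≡.trans
    (sumTo-cong j (λ k → coeff (*S≈ (F k) (G (j ∸ k))) m m≤n))
    (≡.sym (≡.trans (≡.cong (λ H → H m) (PB.⊠-coeff F G j)) (∑-at j _ m)))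
    where
    sumTo-cong : ∀ j {h h′ : ℕ → ℤ} → (∀ k → h k ≡ h′ k) → sumTo j h ≡ sumTo j h′
    sumTo-cong zero    e = e 0
    sumTo-cong (suc j) e = ≡.cong₂ ℤ._+_ (sumTo-cong j e) (e (suc j))

  sumS≈ : ∀ k f → sumS k f S.≈ ∑ k f
  sumS≈ k f = coefficientwise λ m _ → ≡.sym (∑-at k f m)

  oneB≈ : oneB B.≈ B.1#
  oneB≈ = coefficientwiseB λ { zero _ → oneS≈ ; (suc j) _ → S.refl }

  prodB-suc : ∀ N f → prodB (suc N) f B.≈ prodB N f B.* f N
  prodB-suc N f = *B≈ (prodB N f) (f N)

  oneMinusX : ℕ → B.Carrier
  oneMinusX a = quadratic S.1# (S.- q^ a) S.0#

  onePlusX : ℕ → B.Carrier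
  onePlusX a = quadratic S.1# (q^ a) S.0#

  oneMinusX² : ℕ → B.Carrier
  oneMinusX² a = quadratic S.1# S.0# (S.- q^ a)

  invOneMinusX-inverse : ∀ a → invOneMinusX a B.* oneMinusX a B.≈ B.1#
  invOneMinusX-inverse a = B.trans (B.*-comm (invOneMinusX a) (oneMinusX a)) (coefficientwiseB λ
    { zero    _ → S.trans (quadratic-⊠₀ _ _ _ _) (S.trans (S.*-identityˡ _) (q^-*0 a))
    ; (suc j) _ → S.trans (linear-⊠ _ _ _ j) (step j) })
    where
    step : ∀ j → S.1# S.* q^ (a * suc j) S.+ S.- q^ a S.* q^ (a * j) S.≈ S.0#
    step j = S-Reasoning.begin
      S.1# S.* q^ (a * suc j) S.+ S.- q^ a S.* q^ (a * j)      S-Reasoning.≈⟨ S.+-congʳ (S.*-identityˡ _) ⟩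
      q^ (a * suc j) S.+ S.- q^ a S.* q^ (a * j)               S-Reasoning.≈⟨ S.+-congʳ (S.trans (q^-cong (ℕP.*-suc a j)) (q^-+ a (a * j))) ⟩
      q^ a S.* q^ (a * j) S.+ S.- q^ a S.* q^ (a * j)          S-Reasoning.≈⟨ S.+-congˡ (S.sym (-‿distribˡ-* (q^ a) (q^ (a * j)))) ⟩
      q^ a S.* q^ (a * j) S.+ S.- (q^ a S.* q^ (a * j))        S-Reasoning.≈⟨ S.-‿inverseʳ _ ⟩
      S.0#                                                     S-Reasoning.∎

  oneMinusX-beyond : ∀ a → n < a → oneMinusX a B.≈ B.1#
  oneMinusX-beyond a n<a = coefficientwiseB λ
    { zero                _ → S.refl
    ; (suc zero)          _ → S.trans (S.-‿cong (q^-beyond a n<a)) -0#≈0#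
    ; (suc (suc zero))    _ → S.refl
    ; (suc (suc (suc j))) _ → S.refl }

  difference-of-squares : ∀ a → oneMinusX a B.* onePlusX a B.≈ oneMinusX² (a + a)
  difference-of-squares a = coefficientwiseB λ
    { zero                _ → S.trans (quadratic-⊠₀ _ _ _ _) (S.*-identityˡ _)
    ; (suc zero)          _ → S.trans (linear-⊠ _ _ _ 0) (S.trans (S.+-cong (S.*-identityˡ _) (S.*-identityʳ _)) (S.-‿inverseʳ (q^ a)))
    ; (suc (suc zero))    _ → S.trans (quadratic-⊠₂ _ _ _ _ 0) (S-Reasoning.begin
        S.1# S.* S.0# S.+ (S.- q^ a S.* q^ a S.+ S.0# S.* S.1#) S-Reasoning.≈⟨ S.+-cong (S.zeroʳ _) (S.+-cong (S.sym (-‿distribˡ-* (q^ a) (q^ a))) (S.zeroˡ _)) ⟩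
        S.0# S.+ (S.- (q^ a S.* q^ a) S.+ S.0#)                S-Reasoning.≈⟨ S.trans (S.+-identityˡ _) (S.+-identityʳ _) ⟩
        S.- (q^ a S.* q^ a)                                    S-Reasoning.≈⟨ S.-‿cong (q^-+ a a) ⟨
        S.- q^ (a + a)                                         S-Reasoning.∎)
    ; (suc (suc (suc j))) _ → S.trans (quadratic-⊠₂ _ _ _ _ (suc j)) (S.trans
        (S.+-cong (S.zeroʳ _) (S.+-cong (S.trans (S.*-congˡ (S.reflexive (linear-vanishes j))) (S.zeroʳ _)) (S.zeroˡ _)))
        (S.trans (S.+-identityˡ _) (S.+-identityˡ _))) }
    where
    linear-vanishes : ∀ j → onePlusX a (suc (suc j)) ≡ S.0#
    linear-vanishes zero    = ≡.refl
    linear-vanishes (suc j) = ≡.refl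

  difference-coeff : ∀ F G j → (F B.+ B.- G) j S.≈ F j S.+ S.- G j
  difference-coeff F G j = S.reflexive (≡.trans (⊞-coeffB F (B.- G) j) (≡.cong (λ t → F j S.+ t) (⊟-coeffB G j)))

  -- The x-series Σ_t f t·x^{2t}.
  spreadEven : (ℕ → Series) → B.Carrier
  spreadEven f zero          = f 0
  spreadEven f (suc zero)    = S.0#
  spreadEven f (suc (suc j)) = spreadEven (f ∘ suc) j

  spreadEven-even : ∀ f t → spreadEven f (double t) ≡ f t
  spreadEven-even f zero    = ≡.refl
  spreadEven-even f (suc t) = spreadEven-even (f ∘ suc) t

  spreadEven-odd : ∀ f t → spreadEven f (suc (double t)) ≡ S.0#
  spreadEven-odd f zero    = ≡.refl
  spreadEven-odd f (suc t) = spreadEven-odd (f ∘ suc) t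

  -- The substitution x ↦ q^M x, a ring endomorphism of the x-series.
  module Dilation (M : ℕ) where
    σ : B.Carrier → B.Carrier
    σ F j = q^ (M * j) S.* F j

    σ-0 : ∀ F → σ F 0 S.≈ F 0
    σ-0 F = S.trans (S.*-congʳ (q^-*0 M)) (S.*-identityˡ (F 0))

    σ-cong : ∀ {F G} → F B.≈ G → σ F B.≈ σ G
    σ-cong F≈G = coefficientwiseB λ j _ → S.*-congˡ (coeffB F≈G j _)

    σ-1 : σ B.1# B.≈ B.1#
    σ-1 = coefficientwiseB λ
      { zero    _ → S.trans (S.*-identityʳ _) (q^-*0 M)
      ; (suc j) _ → S.zeroʳ _ }

    σ-*-at : ∀ F G j → σ (F B.* G) j S.≈ (σ F B.* σ G) j
    σ-*-at F G j = S-Reasoning.begin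
      q^ (M * j) S.* (F B.* G) j
        S-Reasoning.≈⟨ S.*-congˡ (S.reflexive (⊠-coeffB F G j)) ⟩
      q^ (M * j) S.* ∑ j (λ k → F k S.* G (j ∸ k))
        S-Reasoning.≈⟨ ∑-*ˡ j _ _ ⟩
      ∑ j (λ k → q^ (M * j) S.* (F k S.* G (j ∸ k)))
        S-Reasoning.≈⟨ ∑-cong j (λ k k≤j → S.trans (S.*-congʳ (S.trans (q^-cong (split k≤j)) (q^-+ _ _)))
                                                (interchange _ _ _ _)) ⟩
      ∑ j (λ k → σ F k S.* σ G (j ∸ k))
        S-Reasoning.≈⟨ S.reflexive (⊠-coeffB (σ F) (σ G) j) ⟨
      (σ F B.* σ G) j S-Reasoning.∎
      where
      split : ∀ {k} → k ≤ j → M * j ≡ M * k + M * (j ∸ k)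
      split {k} k≤j = ≡.trans (≡.cong (M *_) (≡.sym (ℕP.m+[n∸m]≡n k≤j))) (ℕP.*-distribˡ-+ M k (j ∸ k))
      interchange = solveS 4 (λ a b c d → (a :* b) :* (c :* d) := (a :* c) :* (b :* d)) S.refl

    σ-* : ∀ F G → σ (F B.* G) B.≈ σ F B.* σ G
    σ-* F G = coefficientwiseB λ j _ → σ-*-at F G j

    σ-invOneMinusX : ∀ a → σ (invOneMinusX a) B.≈ invOneMinusX (a + M)
    σ-invOneMinusX a = coefficientwiseB λ j _ →
      S.trans (S.sym (q^-+ (M * j) (a * j)))
              (q^-cong (≡.trans (ℕP.+-comm (M * j) (a * j)) (≡.sym (ℕP.*-distribʳ-+ j a M))))

    σ-difference : ∀ F G → σ (F B.+ B.- G) B.≈ σ F B.+ B.- σ G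
    σ-difference F G = coefficientwiseB λ j _ → S-Reasoning.begin
      q^ (M * j) S.* (F B.+ B.- G) j                    S-Reasoning.≈⟨ S.*-congˡ (difference-coeff F G j) ⟩
      q^ (M * j) S.* (F j S.+ S.- G j)                  S-Reasoning.≈⟨ solveS 3 (λ q f g → q :* (f :+ :- g) := q :* f :+ :- (q :* g))
                                                                               S.refl (q^ (M * j)) (F j) (G j) ⟩
      q^ (M * j) S.* F j S.+ S.- (q^ (M * j) S.* G j)   S-Reasoning.≈⟨ difference-coeff (σ F) (σ G) j ⟨
      (σ F B.+ B.- σ G) j                               S-Reasoning.∎

    -- For M ≥ 1, a solution D of D·A = σD with A(0) = 1 and D(0) = 0 vanishes:
    -- once its coefficients below degree j + 1 vanish, the equation in degree
    -- j + 1 reads D_{j+1} = q^{M(j+1)} D_{j+1}.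
    homogeneous-vanishes : 1 ≤ M → ∀ {A D} → A 0 S.≈ S.1# → D B.* A B.≈ σ D → D 0 S.≈ S.0# →
                           ∀ j k → k ≤ j → D k S.≈ S.0#
    homogeneous-vanishes 1≤M {A} {D} A₀≈1 DA≈σD D₀≈0 = vanish
      where
      vanish : ∀ j k → k ≤ j → D k S.≈ S.0#
      vanish zero    .zero z≤n = D₀≈0
      vanish (suc j) k k≤ with ℕP.m≤n⇒m<n∨m≡n k≤
      ... | inj₁ (s≤s k≤j) = vanish j k k≤j
      ... | inj₂ ≡.refl    = cancel (geometric (M * suc j) (ℕP.*-mono-≤ 1≤M (s≤s z≤n))) (S-Reasoning.begin
        D (suc j)                       S-Reasoning.≈⟨ S.*-identityʳ (D (suc j)) ⟨
        D (suc j) S.* S.1#              S-Reasoning.≈⟨ S.*-congˡ A₀≈1 ⟨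
        D (suc j) S.* A 0               S-Reasoning.≈⟨ leading-⊠ j D A (vanish j) ⟨
        (D B.* A) (suc j)               S-Reasoning.≈⟨ coeffB DA≈σD (suc j) _ ⟩
        q^ (M * suc j) S.* D (suc j)    S-Reasoning.∎)

    uniqueness : 1 ≤ M → ∀ {A F F′} → A 0 S.≈ S.1# → F B.* A B.≈ σ F → F′ B.* A B.≈ σ F′ →
                 F 0 S.≈ F′ 0 → F B.≈ F′
    uniqueness 1≤M {A} {F} {F′} A₀≈1 FA≈σF F′A≈σF′ F₀≈F′₀ = coefficientwiseB λ j _ → S-Reasoning.begin
      F j                             S-Reasoning.≈⟨ solveS 2 (λ f f′ → f := (f :+ :- f′) :+ f′) S.refl (F j) (F′ j) ⟩
      (F j S.+ S.- F′ j) S.+ F′ j     S-Reasoning.≈⟨ S.+-congʳ (difference-coeff F F′ j) ⟨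
      D j S.+ F′ j                    S-Reasoning.≈⟨ S.+-congʳ (homogeneous-vanishes 1≤M A₀≈1 DA≈σD D₀≈0 j j ℕP.≤-refl) ⟩
      S.0# S.+ F′ j                   S-Reasoning.≈⟨ S.+-identityˡ (F′ j) ⟩
      F′ j                            S-Reasoning.∎
      where
      D : B.Carrier
      D = F B.+ B.- F′

      DA≈σD : D B.* A B.≈ σ D
      DA≈σD = B-Reasoning.begin
        (F B.+ B.- F′) B.* A          B-Reasoning.≈⟨ solveB 3 (λ f f′ a → (f :+ᴮ :-ᴮ f′) :*ᴮ a :=ᴮ f :*ᴮ a :+ᴮ :-ᴮ (f′ :*ᴮ a)) B.refl F F′ A ⟩
        F B.* A B.+ B.- (F′ B.* A)    B-Reasoning.≈⟨ B.+-cong FA≈σF (B.-‿cong F′A≈σF′) ⟩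
        σ F B.+ B.- σ F′              B-Reasoning.≈⟨ σ-difference F F′ ⟨
        σ D                           B-Reasoning.∎

      D₀≈0 : D 0 S.≈ S.0#
      D₀≈0 = S.trans (difference-coeff F F′ 0) (S.trans (S.+-congʳ F₀≈F′₀) (S.-‿inverseʳ (F′ 0)))

module Identity (s r M n : ℕ) (1≤M : 1 ≤ M) where
  open Bivariate n
  open Dilation M

  -- Both sides satisfy the functional equation F·L = σF for
  -- L = (1 - q^s x)(1 - q^{s+r} x).
  L : B.Carrier
  L = oneMinusX s B.* oneMinusX (s + r)

  L₀≈1 : L 0 S.≈ S.1#
  L₀≈1 = S.trans (S.reflexive (⊠-coeffB (oneMinusX s) (oneMinusX (s + r)) 0)) (S.*-identityˡ S.1#)

  P : ℕ → B.Carrier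
  P = lhsTrunc s r M

  P-suc : ∀ N → P (suc N) B.≈ P N B.* (invOneMinusX (s + N * M) B.* invOneMinusX (s + r + N * M))
  P-suc N = B.trans (prodB-suc N _) (B.*-congˡ (*B≈ (invOneMinusX (s + N * M)) (invOneMinusX (s + r + N * M))))

  P₀≈1 : ∀ N → P N 0 S.≈ S.1#
  P₀≈1 zero    = oneS≈
  P₀≈1 (suc N) = S.trans (coeffB (P-suc N) 0 _) (S.trans (S.reflexive (⊠-coeffB _ _ 0)) (S.trans
    (S.*-cong (P₀≈1 N) (S.trans (S.reflexive (⊠-coeffB _ _ 0)) (S.*-cong (q^-*0 (s + N * M)) (q^-*0 (s + r + N * M)))))
    (S.trans (S.*-identityˡ _) (S.*-identityˡ _))))

  pair-inverse : ∀ a b → (invOneMinusX a B.* invOneMinusX b) B.* (oneMinusX a B.* oneMinusX b) B.≈ B.1#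
  pair-inverse a b = B.trans
    (solveB 4 (λ e f l k → (e :*ᴮ f) :*ᴮ (l :*ᴮ k) :=ᴮ (e :*ᴮ l) :*ᴮ (f :*ᴮ k)) B.refl
            (invOneMinusX a) (invOneMinusX b) (oneMinusX a) (oneMinusX b))
    (B.trans (B.*-cong (invOneMinusX-inverse a) (invOneMinusX-inverse b)) (B.*-identityˡ B.1#))

  -- P N·L = σ(P N)·(1 - q^{s+NM} x)(1 - q^{s+r+NM} x): σ shifts each factor of
  -- P N to the next one, so only the first and the last factors remain.
  P-functional : ∀ N → P N B.* L B.≈ σ (P N) B.* (oneMinusX (s + N * M) B.* oneMinusX (s + r + N * M))
  P-functional zero = B.trans (B.*-congʳ oneB≈) (B.trans (B.*-identityˡ L) (B.trans
    (B.*-cong (B.reflexive (≡.cong oneMinusX (≡.sym (ℕP.+-identityʳ s))))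
              (B.reflexive (≡.cong oneMinusX (≡.sym (ℕP.+-identityʳ (s + r))))))
    (B.sym (B.trans (B.*-congʳ (B.trans (σ-cong oneB≈) σ-1)) (B.*-identityˡ _)))))
  P-functional (suc N) = B-Reasoning.begin
    P (suc N) B.* L                              B-Reasoning.≈⟨ B.*-congʳ (P-suc N) ⟩
    (P N B.* Eab) B.* L                          B-Reasoning.≈⟨ solveB 3 (λ p e l → (p :*ᴮ e) :*ᴮ l :=ᴮ (p :*ᴮ l) :*ᴮ e) B.refl (P N) Eab L ⟩
    (P N B.* L) B.* Eab                          B-Reasoning.≈⟨ B.*-congʳ (P-functional N) ⟩
    (σ (P N) B.* Lab) B.* Eab                    B-Reasoning.≈⟨ solveB 3 (λ p l e → (p :*ᴮ l) :*ᴮ e :=ᴮ p :*ᴮ (e :*ᴮ l)) B.refl (σ (P N)) Lab Eab ⟩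
    σ (P N) B.* (Eab B.* Lab)                    B-Reasoning.≈⟨ B.trans (B.*-congˡ (pair-inverse a b)) (B.*-identityʳ _) ⟩
    σ (P N)                                      B-Reasoning.≈⟨ B.trans (B.*-congˡ (pair-inverse (a + M) (b + M))) (B.*-identityʳ _) ⟨
    σ (P N) B.* (Eab′ B.* Lab′)                  B-Reasoning.≈⟨ solveB 3 (λ p e l → p :*ᴮ (e :*ᴮ l) :=ᴮ (p :*ᴮ e) :*ᴮ l) B.refl (σ (P N)) Eab′ Lab′ ⟩
    (σ (P N) B.* Eab′) B.* Lab′                  B-Reasoning.≈⟨ B.*-cong (B.*-congˡ σEab) (B.*-cong (oneMinusX-cong ea) (oneMinusX-cong eb)) ⟨
    (σ (P N) B.* σ Eab) B.* Lab-next             B-Reasoning.≈⟨ B.*-congʳ (σ-* (P N) Eab) ⟨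
    σ (P N B.* Eab) B.* Lab-next                 B-Reasoning.≈⟨ B.*-congʳ (σ-cong (P-suc N)) ⟨
    σ (P (suc N)) B.* Lab-next                   B-Reasoning.∎
    where
    a = s + N * M
    b = s + r + N * M
    Eab  = invOneMinusX a B.* invOneMinusX b
    Lab  = oneMinusX a B.* oneMinusX b
    Eab′ = invOneMinusX (a + M) B.* invOneMinusX (b + M)
    Lab′ = oneMinusX (a + M) B.* oneMinusX (b + M)
    Lab-next = oneMinusX (s + suc N * M) B.* oneMinusX (s + r + suc N * M)
    σEab : σ Eab B.≈ Eab′
    σEab = B.trans (σ-* _ _) (B.*-cong (σ-invOneMinusX a) (σ-invOneMinusX b))
    oneMinusX-cong : ∀ {c d} → c ≡ d → oneMinusX c B.≈ oneMinusX d
    oneMinusX-cong eq = B.reflexive (≡.cong oneMinusX eq)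
    shift : ∀ c → c + suc N * M ≡ c + N * M + M
    shift c = ≡.trans (≡.cong (λ t → c + t) (ℕP.+-comm M (N * M))) (≡.sym (ℕP.+-assoc c (N * M) M))
    ea : s + suc N * M ≡ a + M
    ea = shift s
    eb : s + r + suc N * M ≡ b + M
    eb = shift (s + r)

  -- With N = n + 1 factors the remaining factors are invisible modulo q^{n+1}.
  P-equation : P (suc n) B.* L B.≈ σ (P (suc n))
  P-equation = B.trans (P-functional (suc n)) (B.trans
    (B.*-congˡ (B.trans (B.*-cong (oneMinusX-beyond _ (large s)) (oneMinusX-beyond _ (large (s + r))))
                        (B.*-identityˡ B.1#)))
    (B.*-identityʳ _))
    where
    large : ∀ c → n < c + suc n * M
    large c = ℕP.≤-trans (ℕP.≤-trans (ℕP.≤-reflexive (≡.sym (ℕP.*-identityʳ (suc n)))) (ℕP.*-monoʳ-≤ (suc n) 1≤M))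
                         (ℕP.m≤n+m (suc n * M) c)

  -- The right-hand side is a product G·H, where
  -- G = Σ_k q^{s k} (-q^r; q^M)_k / (q^M; q^M)_k · x^k.
  G : B.Carrier
  G k = q^ (s * k) S.* (poch (ℤ.- + 1) r M k S.* invPoch M M k)

  G-step : ∀ t → G (suc t) S.≈ (q^ s S.* (S.1# S.+ q^ (r + t * M)) S.* G t) S.* invOneMinus (M + t * M)
  G-step t = S.trans
    (S.*-cong (S.trans (q^-cong (ℕP.*-suc s t)) (q^-+ s (s * t)))
              (S.*-cong (S.trans (prodS-suc t _) (S.*-congˡ (factor≈ (+ 1) (r + t * M)))) (prodS-suc t _)))
    (solveS 6 (λ qs u p x i j → (qs :* u) :* ((p :* (con (+ 1) :+ x)) :* (i :* j))
                              := (qs :* (con (+ 1) :+ x) :* (u :* (p :* i))) :* j)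
            S.refl (q^ s) (q^ (s * t)) (poch (ℤ.- + 1) r M t) (q^ (r + t * M)) (invPoch M M t) (invOneMinus (M + t * M)))

  G-linear : ∀ t → G (suc t) S.≈ q^ (M * suc t) S.* G (suc t) S.+ q^ s S.* (S.1# S.+ q^ (r + t * M)) S.* G t
  G-linear t = S.trans (solve-linear (geometric (M + t * M) (ℕP.≤-trans 1≤M (ℕP.m≤m+n M (t * M)))) (G-step t))
                       (S.+-congʳ (S.*-congʳ (q^-cong exponent)))
    where
    exponent : M + t * M ≡ M * suc t
    exponent = ≡.trans (≡.cong (λ u → M + u) (ℕP.*-comm t M)) (≡.sym (ℕP.*-suc M t))

  G-equation : G B.* oneMinusX s B.≈ σ G B.* onePlusX (s + r)
  G-equation = B.trans (B.*-comm G (oneMinusX s)) (B.trans (coefficientwiseB λ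
    { zero    _ → S.trans (quadratic-⊠₀ _ _ _ G) (S.sym (S.trans (quadratic-⊠₀ _ _ _ (σ G)) (S.*-congˡ (σ-0 G))))
    ; (suc t) _ → S.trans (linear-⊠ _ _ G t) (S.trans (recurrence t) (S.sym (linear-⊠ _ _ (σ G) t))) })
    (B.*-comm (onePlusX (s + r)) (σ G)))
    where
    recurrence : ∀ t → S.1# S.* G (suc t) S.+ S.- q^ s S.* G t S.≈
                       S.1# S.* σ G (suc t) S.+ q^ (s + r) S.* σ G t
    recurrence t = S-Reasoning.begin
      S.1# S.* G (suc t) S.+ S.- q^ s S.* G t
        S-Reasoning.≈⟨ S.+-congʳ (S.*-congˡ (G-linear t)) ⟩
      S.1# S.* (Q S.* G (suc t) S.+ q^ s S.* (S.1# S.+ X) S.* G t) S.+ S.- q^ s S.* G t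
        S-Reasoning.≈⟨ solveS 5 (λ Q g qs x gₜ → con (+ 1) :* (Q :* g :+ qs :* (con (+ 1) :+ x) :* gₜ) :+ :- qs :* gₜ
                                        := con (+ 1) :* (Q :* g) :+ qs :* x :* gₜ) S.refl Q (G (suc t)) (q^ s) X (G t) ⟩
      S.1# S.* (Q S.* G (suc t)) S.+ q^ s S.* X S.* G t
        S-Reasoning.≈⟨ S.+-congˡ (S.*-congʳ (S.trans (S.sym (q^-+ s (r + t * M))) (S.trans (q^-cong exponent) (q^-+ (s + r) (M * t))))) ⟩
      S.1# S.* σ G (suc t) S.+ q^ (s + r) S.* q^ (M * t) S.* G t
        S-Reasoning.≈⟨ S.+-congˡ (S.*-assoc _ _ _) ⟩
      S.1# S.* σ G (suc t) S.+ q^ (s + r) S.* σ G t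
        S-Reasoning.∎
      where
      Q = q^ (M * suc t)
      X = q^ (r + t * M)
      exponent : s + (r + t * M) ≡ s + r + M * t
      exponent = ≡.trans (≡.sym (ℕP.+-assoc s r (t * M))) (≡.cong (λ u → s + r + u) (ℕP.*-comm t M))

  -- H = Σ_t q^{2(s+r)t} / (q^{2M}; q^{2M})_t · x^{2t}, with e₂ = 2(s + r)
  e₂ : ℕ
  e₂ = s + r + (s + r)

  1≤2M : 1 ≤ 2 * M
  1≤2M = ℕP.≤-trans 1≤M (ℕP.m≤m+n M (M + 0))

  h : ℕ → Series
  h t = q^ (e₂ * t) S.* invPoch (2 * M) (2 * M) t

  H : B.Carrier
  H = spreadEven h

  h-step : ∀ t → h (suc t) S.≈ (q^ e₂ S.* h t) S.* invOneMinus (2 * M + t * (2 * M))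
  h-step t = S.trans (S.*-cong (S.trans (q^-cong (ℕP.*-suc e₂ t)) (q^-+ e₂ (e₂ * t))) (prodS-suc t _))
    (solveS 4 (λ qe u i j → (qe :* u) :* (i :* j) := (qe :* (u :* i)) :* j) S.refl
            (q^ e₂) (q^ (e₂ * t)) (invPoch (2 * M) (2 * M) t) (invOneMinus (2 * M + t * (2 * M))))

  h-linear : ∀ t → h (suc t) S.≈ q^ (M * suc (suc (double t))) S.* h (suc t) S.+ q^ e₂ S.* h t
  h-linear t = S.trans (solve-linear (geometric (2 * M + t * (2 * M)) (ℕP.≤-trans 1≤2M (ℕP.m≤m+n (2 * M) _))) (h-step t))
                       (S.+-congʳ (S.*-congʳ (q^-cong exponent)))
    where
    arithmetic : ∀ M t → 2 * M + t * (2 * M) ≡ M * (2 + 2 * t)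
    arithmetic = solve-∀
    exponent : 2 * M + t * (2 * M) ≡ M * suc (suc (double t))
    exponent = ≡.trans (arithmetic M t) (≡.cong (λ u → M * suc (suc u)) (≡.sym (double≡2* t)))

  H-equation : H B.* oneMinusX² e₂ B.≈ σ H
  H-equation = B.trans (B.*-comm H (oneMinusX² e₂)) (coefficientwiseB λ
    { zero          _ → S.trans (quadratic-⊠₀ _ _ _ H) (S.trans (S.*-identityˡ (H 0)) (S.sym (σ-0 H)))
    ; (suc zero)    _ → S.trans (quadratic-⊠₁ _ _ _ H) (S.trans (S.+-cong (S.zeroʳ S.1#) (S.zeroˡ (H 0)))
                          (S.trans (S.+-identityˡ S.0#) (S.sym (S.zeroʳ (q^ (M * 1))))))
    ; (suc (suc j)) _ → S.trans (quadratic-⊠₂ _ _ _ H j) (recurrence j) })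
    where
    recurrence : ∀ j → S.1# S.* H (suc (suc j)) S.+ (S.0# S.* H (suc j) S.+ S.- q^ e₂ S.* H j) S.≈ σ H (suc (suc j))
    recurrence j with parity j
    ... | even t = S-Reasoning.begin
      S.1# S.* H (suc (suc (double t))) S.+ (S.0# S.* H (suc (double t)) S.+ S.- q^ e₂ S.* H (double t))
        S-Reasoning.≈⟨ S.reflexive (≡.cong₂ (λ a b → S.1# S.* a S.+ (S.0# S.* H (suc (double t)) S.+ S.- q^ e₂ S.* b))
                                            (spreadEven-even (h ∘ suc) t) (spreadEven-even h t)) ⟩
      S.1# S.* h (suc t) S.+ (S.0# S.* H (suc (double t)) S.+ S.- q^ e₂ S.* h t)
        S-Reasoning.≈⟨ S.+-congʳ (S.*-congˡ (h-linear t)) ⟩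
      S.1# S.* (Q S.* h (suc t) S.+ q^ e₂ S.* h t) S.+ (S.0# S.* H (suc (double t)) S.+ S.- q^ e₂ S.* h t)
        S-Reasoning.≈⟨ S.+-congˡ (S.trans (S.+-congʳ (S.zeroˡ _)) (S.+-identityˡ _)) ⟩
      S.1# S.* (Q S.* h (suc t) S.+ q^ e₂ S.* h t) S.+ S.- q^ e₂ S.* h t
        S-Reasoning.≈⟨ solveS 4 (λ Q g qe gₜ → con (+ 1) :* (Q :* g :+ qe :* gₜ) :+ :- qe :* gₜ := Q :* g)
                                S.refl Q (h (suc t)) (q^ e₂) (h t) ⟩
      Q S.* h (suc t)
        S-Reasoning.≈⟨ S.*-congˡ (S.reflexive (≡.sym (spreadEven-even (h ∘ suc) t))) ⟩
      σ H (suc (suc (double t)))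
        S-Reasoning.∎
      where Q = q^ (M * suc (suc (double t)))
    ... | odd t = S-Reasoning.begin
      S.1# S.* H (suc (suc (suc (double t)))) S.+ (S.0# S.* H (suc (suc (double t))) S.+ S.- q^ e₂ S.* H (suc (double t)))
        S-Reasoning.≈⟨ S.reflexive (≡.cong₂ (λ a b → S.1# S.* a S.+ (S.0# S.* H (suc (suc (double t))) S.+ S.- q^ e₂ S.* b))
                                            (spreadEven-odd (h ∘ suc) t) (spreadEven-odd h t)) ⟩
      S.1# S.* S.0# S.+ (S.0# S.* H (suc (suc (double t))) S.+ S.- q^ e₂ S.* S.0#)
        S-Reasoning.≈⟨ S.trans (S.+-cong (S.zeroʳ _) (S.+-cong (S.zeroˡ _) (S.zeroʳ _)))
                               (S.trans (S.+-identityˡ _) (S.+-identityˡ _)) ⟩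
      S.0#
        S-Reasoning.≈⟨ S.trans (S.*-congˡ (S.reflexive (spreadEven-odd (h ∘ suc) t))) (S.zeroʳ _) ⟨
      σ H (suc (suc (suc (double t))))
        S-Reasoning.∎

  GH-equation : (G B.* H) B.* L B.≈ σ (G B.* H)
  GH-equation = B-Reasoning.begin
    (G B.* H) B.* (l₁ B.* l₂)            B-Reasoning.≈⟨ solveB 4 (λ g h a b → (g :*ᴮ h) :*ᴮ (a :*ᴮ b) :=ᴮ (g :*ᴮ a) :*ᴮ (h :*ᴮ b)) B.refl G H l₁ l₂ ⟩
    (G B.* l₁) B.* (H B.* l₂)            B-Reasoning.≈⟨ B.*-congʳ G-equation ⟩
    (σ G B.* p) B.* (H B.* l₂)           B-Reasoning.≈⟨ solveB 4 (λ g p h b → (g :*ᴮ p) :*ᴮ (h :*ᴮ b) :=ᴮ g :*ᴮ (h :*ᴮ (b :*ᴮ p))) B.refl (σ G) p H l₂ ⟩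
    σ G B.* (H B.* (l₂ B.* p))           B-Reasoning.≈⟨ B.*-congˡ (B.*-congˡ (difference-of-squares (s + r))) ⟩
    σ G B.* (H B.* oneMinusX² e₂)        B-Reasoning.≈⟨ B.*-congˡ H-equation ⟩
    σ G B.* σ H                          B-Reasoning.≈⟨ σ-* G H ⟨
    σ (G B.* H)                          B-Reasoning.∎
    where
    l₁ = oneMinusX s
    l₂ = oneMinusX (s + r)
    p = onePlusX (s + r)

  GH₀≈1 : (G B.* H) 0 S.≈ S.1#
  GH₀≈1 = S.trans (S.reflexive (⊠-coeffB G H 0)) (S.trans
    (S.*-cong (S.*-cong (q^-*0 s) (S.*-cong oneS≈ oneS≈))
              (S.*-cong (q^-*0 e₂) oneS≈))
    (solveS 0 (con (+ 1) :* (con (+ 1) :* con (+ 1)) :* (con (+ 1) :* con (+ 1)) := con (+ 1)) S.refl))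

  P≈GH : P (suc n) B.≈ G B.* H
  P≈GH = uniqueness 1≤M L₀≈1 P-equation GH-equation (S.trans (P₀≈1 (suc n)) (S.sym GH₀≈1))

  -- Only the terms k ≡ j (mod 2) of (G·H)_j = Σ_k G_k H_{j-k} survive.
  GH-even : ∀ m → (G B.* H) (double m) S.≈ ∑ m (λ i → G (double i) S.* h (m ∸ i))
  GH-even m = S.trans (S.reflexive (⊠-coeffB G H (double m))) (S.trans
    (∑-even m (λ k → G k S.* H (double m ∸ k)) (λ i i<m → S.trans
      (S.*-congˡ (S.reflexive (≡.trans (≡.cong H (double-∸-odd m i i<m)) (spreadEven-odd h (m ∸ suc i)))))
      (S.zeroʳ _)))
    (∑-cong m (λ i _ → S.*-congˡ (S.reflexive (≡.trans (≡.cong H (double-∸ m i)) (spreadEven-even h (m ∸ i)))))))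

  GH-odd : ∀ m → (G B.* H) (suc (double m)) S.≈ ∑ m (λ i → G (suc (double i)) S.* h (m ∸ i))
  GH-odd m = S.trans (S.reflexive (⊠-coeffB G H (suc (double m)))) (S.trans
    (∑-odd m (λ k → G k S.* H (suc (double m) ∸ k)) (λ i i≤m → S.trans
      (S.*-congˡ (S.reflexive (≡.trans (≡.cong H (odd-∸-double m i i≤m)) (spreadEven-odd h (m ∸ i)))))
      (S.zeroʳ _)))
    (∑-cong m (λ i _ → S.*-congˡ (S.reflexive (≡.trans (≡.cong H (double-∸ m i)) (spreadEven-even h (m ∸ i)))))))

  -- The right-hand side of the theorem for j = 2m + e, e = ⌈j/2⌉ - ⌊j/2⌋, is
  -- q^{sj}/(q^{2M};q^{2M})_m · Σ_{i ≤ m} rhsTerm m e i; by definition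
  -- rhsSeries s r M j = rhs ⌊j/2⌋ (⌈j/2⌉ ∸ ⌊j/2⌋) j.
  rhsTerm : ℕ → ℕ → ℕ → Series
  rhsTerm m e i = (((qbinom (2 * M) m i *S poch (ℤ.- + 1) r (2 * M) (i + e)) *S poch (ℤ.- + 1) (M + r) (2 * M) i)
                   *S invPoch M (2 * M) (i + e)) *S q^ (2 * r * (m ∸ i))

  rhs : ℕ → ℕ → ℕ → Series
  rhs m e j = (q^ (s * j) *S invPoch (2 * M) (2 * M) m) *S sumS m (rhsTerm m e)

  rhsTerm-factors : ℕ → ℕ → ℕ → Series
  rhsTerm-factors m e i =
    ((((((poch (+ 1) (2 * M) (2 * M) m S.* invPoch (2 * M) (2 * M) i) S.* invPoch (2 * M) (2 * M) (m ∸ i))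
       S.* poch (ℤ.- + 1) r (2 * M) (i + e)) S.* poch (ℤ.- + 1) (M + r) (2 * M) i) S.* invPoch M (2 * M) (i + e))
       S.* q^ (2 * r * (m ∸ i)))

  rhs≈ : ∀ m e j → rhs m e j S.≈ (q^ (s * j) S.* invPoch (2 * M) (2 * M) m) S.* ∑ m (rhsTerm-factors m e)
  rhs≈ m e j = *S≈-cong (*S≈ _ _) (S.trans (sumS≈ m _) (∑-cong m (λ i _ →
    *S≈-cong (*S≈-cong (*S≈-cong (*S≈-cong (*S≈-cong (*S≈ _ _) S.refl) S.refl) S.refl) S.refl) S.refl)))

  -- Termwise, the summands are G_{e+2i} h_{m-i}, using
  --   (-q^r; q^M)_{e+2i} = (-q^r; q^{2M})_{i+e} (-q^{M+r}; q^{2M})_i,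
  --   (q^M; q^M)_{e+2i}  = (q^M; q^{2M})_{i+e} (q^{2M}; q^{2M})_i,
  --   [m choose i]_{q^{2M}} / (q^{2M}; q^{2M})_m = 1/((q^{2M}; q^{2M})_i (q^{2M}; q^{2M})_{m-i}).
  rhs-summand : ∀ e m i → i ≤ m →
    poch (ℤ.- + 1) r (2 * M) (i + e) S.* poch (ℤ.- + 1) (M + r) (2 * M) i S.≈ poch (ℤ.- + 1) r M (e + double i) →
    invPoch M (2 * M) (i + e) S.* invPoch (2 * M) (2 * M) i S.≈ invPoch M M (e + double i) →
    (q^ (s * (e + double m)) S.* invPoch (2 * M) (2 * M) m) S.* rhsTerm-factors m e i S.≈ G (e + double i) S.* h (m ∸ i)
  rhs-summand e m i i≤m poch-split invPoch-split = S-Reasoning.begin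
    (a S.* b) S.* ((((((c S.* d) S.* d′) S.* f) S.* g) S.* k) S.* w)
      S-Reasoning.≈⟨ solveS 9 (λ a b c d d′ f g k w → (a :* b) :* ((((((c :* d) :* d′) :* f) :* g) :* k) :* w)
                                               := ((b :* c) :* ((f :* g) :* ((k :* d) :* (a :* w)))) :* d′)
                              S.refl a b c d d′ f g k w ⟩
    ((b S.* c) S.* ((f S.* g) S.* ((k S.* d) S.* (a S.* w)))) S.* d′
      S-Reasoning.≈⟨ S.*-congʳ (S.*-cong (invPoch-poch (2 * M) (2 * M) m 1≤2M)
                                         (S.*-cong poch-split (S.*-cong invPoch-split exponents))) ⟩
    (S.1# S.* (Pₖ S.* (Iₖ S.* (q^ (s * (e + double i)) S.* q^ (e₂ * (m ∸ i)))))) S.* d′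
      S-Reasoning.≈⟨ solveS 5 (λ p i′ x y d′ → (con (+ 1) :* (p :* (i′ :* (x :* y)))) :* d′ := (x :* (p :* i′)) :* (y :* d′))
                              S.refl Pₖ Iₖ (q^ (s * (e + double i))) (q^ (e₂ * (m ∸ i))) d′ ⟩
    G (e + double i) S.* h (m ∸ i)
      S-Reasoning.∎
    where
    a = q^ (s * (e + double m))
    b = invPoch (2 * M) (2 * M) m
    c = poch (+ 1) (2 * M) (2 * M) m
    d = invPoch (2 * M) (2 * M) i
    d′ = invPoch (2 * M) (2 * M) (m ∸ i)
    f = poch (ℤ.- + 1) r (2 * M) (i + e)
    g = poch (ℤ.- + 1) (M + r) (2 * M) i
    k = invPoch M (2 * M) (i + e)
    w = q^ (2 * r * (m ∸ i))
    Pₖ = poch (ℤ.- + 1) r M (e + double i)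
    Iₖ = invPoch M M (e + double i)
    exponents : a S.* w S.≈ q^ (s * (e + double i)) S.* q^ (e₂ * (m ∸ i))
    exponents = S.trans (S.sym (q^-+ _ _)) (S.trans (q^-cong exponent) (q^-+ _ _))
      where
      arithmetic : ∀ s r e i t → s * (e + 2 * (i + t)) + 2 * r * t ≡ s * (e + 2 * i) + (s + r + (s + r)) * t
      arithmetic = solve-∀
      exponent : s * (e + double m) + 2 * r * (m ∸ i) ≡ s * (e + double i) + e₂ * (m ∸ i)
      exponent = ≡.trans (≡.cong (λ u → s * (e + u) + 2 * r * (m ∸ i))
                                 (≡.trans (double≡2* m) (≡.cong (2 *_) (≡.sym (ℕP.m+[n∸m]≡n i≤m)))))
                 (≡.trans (arithmetic s r e i (m ∸ i))
                          (≡.cong (λ u → s * (e + u) + e₂ * (m ∸ i)) (≡.sym (double≡2* i))))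

  rhs-as-sum : ∀ e m →
    (∀ i → poch (ℤ.- + 1) r (2 * M) (i + e) S.* poch (ℤ.- + 1) (M + r) (2 * M) i S.≈ poch (ℤ.- + 1) r M (e + double i)) →
    (∀ i → invPoch M (2 * M) (i + e) S.* invPoch (2 * M) (2 * M) i S.≈ invPoch M M (e + double i)) →
    rhs m e (e + double m) S.≈ ∑ m (λ i → G (e + double i) S.* h (m ∸ i))
  rhs-as-sum e m poch-split invPoch-split = S.trans (rhs≈ m e (e + double m)) (S.trans (∑-*ˡ m _ _)
    (∑-cong m (λ i i≤m → rhs-summand e m i i≤m (poch-split i) (invPoch-split i))))

  poch-split-even : ∀ i → poch (ℤ.- + 1) r (2 * M) (i + 0) S.* poch (ℤ.- + 1) (M + r) (2 * M) i S.≈ poch (ℤ.- + 1) r M (double i)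
  poch-split-even i = S.trans (S.*-congʳ (S.reflexive (≡.cong (poch (ℤ.- + 1) r (2 * M)) (ℕP.+-identityʳ i))))
                              (S.sym (progression-even (pochFactor (ℤ.- + 1)) r M i))

  poch-split-odd : ∀ i → poch (ℤ.- + 1) r (2 * M) (i + 1) S.* poch (ℤ.- + 1) (M + r) (2 * M) i S.≈ poch (ℤ.- + 1) r M (suc (double i))
  poch-split-odd i = S.trans (S.*-congʳ (S.reflexive (≡.cong (poch (ℤ.- + 1) r (2 * M)) (ℕP.+-comm i 1))))
                             (S.sym (progression-odd (pochFactor (ℤ.- + 1)) r M i))

  -- and the same for the inverses, whose odd part starts at q^{M+M} = q^{2M}
  2M≡M+M : 2 * M ≡ M + M
  2M≡M+M = ≡.cong (λ t → M + t) (ℕP.+-identityʳ M)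

  invPoch-split-even : ∀ i → invPoch M (2 * M) (i + 0) S.* invPoch (2 * M) (2 * M) i S.≈ invPoch M M (double i)
  invPoch-split-even i = S.trans (S.*-cong (S.reflexive (≡.cong (invPoch M (2 * M)) (ℕP.+-identityʳ i)))
                                           (S.reflexive (≡.cong (λ c → invPoch c (2 * M) i) 2M≡M+M)))
                                 (S.sym (progression-even invOneMinus M M i))

  invPoch-split-odd : ∀ i → invPoch M (2 * M) (i + 1) S.* invPoch (2 * M) (2 * M) i S.≈ invPoch M M (suc (double i))
  invPoch-split-odd i = S.trans (S.*-cong (S.reflexive (≡.cong (invPoch M (2 * M)) (ℕP.+-comm i 1)))
                                          (S.reflexive (≡.cong (λ c → invPoch c (2 * M) i) 2M≡M+M)))
                                (S.sym (progression-odd invOneMinus M M i))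

  rhs≈GH : ∀ j → rhsSeries s r M j S.≈ (G B.* H) j
  rhs≈GH j with parity j
  ... | even m = S.trans (S.reflexive (≡.cong₂ (λ a b → rhs a b (double m)) (⌊double/2⌋ m) e≡0))
                   (S.trans (rhs-as-sum 0 m poch-split-even invPoch-split-even) (S.sym (GH-even m)))
    where e≡0 : ⌈ double m /2⌉ ∸ ⌊ double m /2⌋ ≡ 0
          e≡0 = ≡.trans (≡.cong₂ _∸_ (⌊odd/2⌋ m) (⌊double/2⌋ m)) (ℕP.n∸n≡0 m)
  ... | odd m  = S.trans (S.reflexive (≡.cong₂ (λ a b → rhs a b (suc (double m))) (⌊odd/2⌋ m) e≡1))
                   (S.trans (rhs-as-sum 1 m poch-split-odd invPoch-split-odd) (S.sym (GH-odd m)))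
    where e≡1 : ⌈ suc (double m) /2⌉ ∸ ⌊ suc (double m) /2⌋ ≡ 1
          e≡1 = ≡.trans (≡.cong₂ _∸_ (≡.cong suc (⌊double/2⌋ m)) (⌊odd/2⌋ m)) (ℕP.m+n∸n≡m 1 m)

theorem5p2 : (s M r : ℕ) → 1 ≤ s → 1 ≤ M → s + r ≤ M →
    (j n : ℕ) → lhsCoeff s r M j n ≡ rhsSeries s r M j n
theorem5p2 s M r _ 1≤M _ j n = begin
  lhsCoeff s r M j n      ≡⟨ coeff (coeffB P≈GH j _) n ℕP.≤-refl ⟩
  (G B.* H) j n           ≡⟨ coeff (rhs≈GH j) n ℕP.≤-refl ⟨
  rhsSeries s r M j n     ∎
  where
  open Bivariate n using (module B; coeff; coeffB)
  open Identity s r M n 1≤M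
  open ≡.≡-Reasoning
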